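{- For every positive integer $n$ and every integer $k\ge0$, \[ \widehat{D}_{2n}^{(-2k-1)}\equiv0\pmod{2^{2n-1}}. \]
   Context: For $k\in\mathbb{Z}$ and $|z|<1$, let $\mathrm{Li}_k(z)=\sum_{n\ge1}z^n/n^k$ and $\mathrm{A}_k(z)=\mathrm{Li}_k(z)-\mathrm{Li}_k(-z)$. The polycotangent numbers $\widehat{D}_n^{(k)}$ are defined by \[ \frac{\mathrm{A}_k(\tanh(t/2))}{\tanh t}=\sum_{n\ge0}\widehat{D}_n^{(k)}\frac{t^n}{n!}. \] For $k\le0$ these are integers. -}

module Defs where

import Data.Nat as ℕ
open import Data.Nat using (ℕ; zero; suc; _∸_)
open import Data.Nat.Properties using (m^n≢0; _!≢0)
open import Data.Nat using (_!)
open import Data.Integer as ℤ using (ℤ; +_)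
import Data.Rational as ℚ
open import Data.Rational using (ℚ; 0ℚ; 1ℚ; _+_; _*_; -_)
open import Data.Bool using (Bool; true; false; if_then_else_)

isEven : ℕ → Bool
isEven zero          = true
isEven (suc zero)    = false
isEven (suc (suc n)) = isEven n

-- Formal power series over ℚ, given by their coefficient sequences:
-- a series f stands for Σ_{n≥0} f n · tⁿ.
Series : Set
Series = ℕ → ℚ

sumTo : ℕ → (ℕ → ℚ) → ℚ
sumTo zero    f = f 0
sumTo (suc n) f = sumTo n f + f (suc n)

_⊛_ : Series → Series → Series
(f ⊛ g) n = sumTo n (λ i → f i * g (n ∸ i))

oneS : Series
oneS zero    = 1ℚ
oneS (suc _) = 0ℚ

powS : Series → ℕ → Series
powS f zero    = oneS
powS f (suc j) = f ⊛ powS f j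

-- composition a(g(t)) = Σ_j a_j g(t)^j; meaningful when g 0 = 0
-- (then only j ≤ n contributes to the coefficient of tⁿ).
compose : Series → Series → Series
compose a g n = sumTo n (λ j → a j * powS g j n)

-- multiplicative inverse of a series c with c 0 = 1:
-- 1/c = 1/(1-u) = Σ_j u^j with u = 1 - c (so u 0 = 0).
invS : Series → Series
invS c = compose (λ _ → 1ℚ) u
  where
  u : Series
  u zero    = 0ℚ
  u (suc n) = - c (suc n)

-- f(t)/t for a series f with f 0 = 0
shiftS : Series → Series
shiftS f n = f (suc n)

invFact : ℕ → ℚ
invFact n = (+ 1) ℚ./ (n !)
  where instance _ = n !≢0

invPow2 : ℕ → ℚ
invPow2 n = (+ 1) ℚ./ (2 ℕ.^ n)
  where instance _ = m^n≢0 2 n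

-- sinh(c t) with c = 1/2^e : coefficients cⁿ/n! at odd n
sinhS : ℕ → Series
sinhS e n = if isEven n then 0ℚ else invFact n * invPow2 (e ℕ.* n)

-- cosh(c t) with c = 1/2^e : coefficients cⁿ/n! at even n
coshS : ℕ → Series
coshS e n = if isEven n then invFact n * invPow2 (e ℕ.* n) else 0ℚ

tanhHalf : Series
tanhHalf = sinhS 1 ⊛ invS (coshS 1)

-- For m : ℕ (i.e. k = -m ≤ 0), the coefficients of
--   A_{-m}(z) = Li_{-m}(z) - Li_{-m}(-z) = Σ_{j≥1} (j^m - (-1)^j j^m) z^j
--             = Σ_{j odd} 2 j^m z^j.
ASeries : ℕ → Series
ASeries m j = if isEven j then 0ℚ else (+ (2 ℕ.* j ℕ.^ m) ℚ./ 1)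

-- A_{-m}(tanh(t/2)) / tanh t
--   = (A_{-m}(tanh(t/2)) · cosh t) / sinh t
--   = ((A_{-m}(tanh(t/2)) · cosh t)/t) · (sinh t / t)⁻¹
polycotEGF : ℕ → Series
polycotEGF m = shiftS (compose (ASeries m) tanhHalf ⊛ coshS 0) ⊛ invS (shiftS (sinhS 0))

-- Polycotangent numbers with non-positive upper index:
--   Dhat m n = \widehat{D}_n^{(-m)} = n! · [tⁿ] A_{-m}(tanh(t/2)) / tanh t
Dhat : ℕ → ℕ → ℚ
Dhat m n = (+ (n !) ℚ./ 1) * polycotEGF m n

-- Write T = tanh(t/2). Since T′ = T / sinh t, the Euler operator z d/dz acts on A(T) as sinh t · d/dt,
-- and A₀(T) = 2T/(1 − T²) = sinh t. Hence A_{−m}(T) = sinh t · X_m with X_{2k} = P_k(sinh² t) and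
-- X_{2k+1} = cosh t · Q_k(sinh² t), where P_k, Q_k have natural coefficients and the i-th coefficient is
-- divisible by 2^i. The generating function A_{−m}(T) cosh t / sinh t is then, for m = 2k + 1,
-- (1 + sinh² t) · Q_k(sinh² t). Now n!·[tⁿ] sinh² t is 0 or 2^{n−1}, Hurwitz series (n!·[tⁿ] integral)
-- multiply by binomial convolution, so n!·[tⁿ] of sinh^{2j} t is divisible by 2^{n−j}; together with
-- 2^j ∣ [x^j] Q_k this makes n!·[tⁿ] of the whole series divisible by 2^{n−1}.

module Submission where

open import Defs
open import Algebra.Bundles using (CommutativeSemiring)
import Algebra.Structures.Biased as Biased
open import Data.Bool using (true; false; not; if_then_else_)
open import Data.Bool.Properties using (not-involutive)
open import Data.Integer using (+_)
import Data.Integer as Z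
import Data.Integer.Properties as ℤₚ
open import Data.List using (_∷_; [])
open import Data.Maybe using (nothing)
open import Data.Nat using (ℕ; zero; suc; _∸_; _^_; _!; _≤_; _<_; z≤n; s≤s; NonZero)
import Data.Nat as N
open import Data.Nat.Divisibility using (_∣_; divides)
import Data.Nat.Divisibility as ℕ∣
open import Data.Nat.Combinatorics using (_C_; k![n∸k]!∣n!)
open import Data.Nat.Combinatorics.Specification using (nCk≡n!/k![n-k]!)
open import Data.Nat.DivMod using (m/n*n≡m)
import Data.Nat.Properties as ℕₚ
open import Data.Nat.Properties using (m^n≢0; _!≢0)
open import Data.Nat.Tactic.RingSolver using () renaming (ring to ℕ-ring)
open import Function using (_∘_)
open import Data.Product using (_×_; _,_; proj₁; proj₂; ∃-syntax)
open import Data.Rational using (ℚ; 0ℚ; 1ℚ; _+_; _*_; -_; _/_; toℚᵘ)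
open import Data.Rational.Properties
  using ( +-assoc; +-comm; +-identityˡ; +-identityʳ; +-inverseʳ
        ; *-assoc; *-comm; *-identityˡ; *-identityʳ; *-zeroˡ; *-zeroʳ
        ; *-distribˡ-+; *-distribʳ-+; +-0-group; +-*-commutativeRing
        ; toℚᵘ-injective; toℚᵘ-homo-+; toℚᵘ-homo-*; toℚᵘ-fromℚᵘ )
import Data.Rational.Unnormalised as ℚᵘ
import Data.Rational.Unnormalised.Properties as ℚᵘₚ
open import Algebra.Properties.Group +-0-group using (∙-cancelʳ)
open import Relation.Binary.Bundles using (Setoid)
open import Relation.Binary.PropositionalEquality
import Relation.Binary.Reasoning.Setoid as SetoidReasoning
open import Tactic.RingSolver using (solve; solve-∀)
import Tactic.RingSolver.Core.AlmostCommutativeRing as ACR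

ℚ-ring : ACR.AlmostCommutativeRing _ _
ℚ-ring = ACR.fromCommutativeRing +-*-commutativeRing (λ _ → nothing)

fromℕ : ℕ → ℚ
fromℕ n = + n / 1

1/ℕ_ : (d : ℕ) .{{_ : NonZero d}} → ℚ
1/ℕ d = + 1 / d

private
  toℚᵘ-/ : ∀ n d → toℚᵘ (+ n / suc d) ℚᵘ.≃ ℚᵘ.mkℚᵘ (+ n) d
  toℚᵘ-/ n d = toℚᵘ-fromℚᵘ (ℚᵘ.mkℚᵘ (+ n) d)

fromℕ-homo-+ : ∀ m n → fromℕ (m N.+ n) ≡ fromℕ m + fromℕ n
fromℕ-homo-+ m n = toℚᵘ-injective (begin
  toℚᵘ (fromℕ (m N.+ n))                  ≈⟨ toℚᵘ-/ (m N.+ n) 0 ⟩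
  ℚᵘ.mkℚᵘ (+ (m N.+ n)) 0                 ≈⟨ ℚᵘ.*≡* cross ⟩
  ℚᵘ.mkℚᵘ (+ m) 0 ℚᵘ.+ ℚᵘ.mkℚᵘ (+ n) 0    ≈⟨ ℚᵘₚ.+-cong (toℚᵘ-/ m 0) (toℚᵘ-/ n 0) ⟨
  toℚᵘ (fromℕ m) ℚᵘ.+ toℚᵘ (fromℕ n)      ≈⟨ toℚᵘ-homo-+ (fromℕ m) (fromℕ n) ⟨
  toℚᵘ (fromℕ m + fromℕ n)                ∎)
  where
  open ℚᵘₚ.≃-Reasoning
  cross : + (m N.+ n) Z.* Z.1ℤ ≡ (+ m Z.* Z.1ℤ Z.+ + n Z.* Z.1ℤ) Z.* Z.1ℤ
  cross = trans (ℤₚ.*-identityʳ _) (trans (ℤₚ.pos-+ m n) (sym (trans (ℤₚ.*-identityʳ _)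
            (cong₂ Z._+_ (ℤₚ.*-identityʳ (+ m)) (ℤₚ.*-identityʳ (+ n))))))

fromℕ-homo-* : ∀ m n → fromℕ (m N.* n) ≡ fromℕ m * fromℕ n
fromℕ-homo-* m n = toℚᵘ-injective (begin
  toℚᵘ (fromℕ (m N.* n))                  ≈⟨ toℚᵘ-/ (m N.* n) 0 ⟩
  ℚᵘ.mkℚᵘ (+ (m N.* n)) 0                 ≈⟨ ℚᵘ.*≡* cross ⟩
  ℚᵘ.mkℚᵘ (+ m) 0 ℚᵘ.* ℚᵘ.mkℚᵘ (+ n) 0    ≈⟨ ℚᵘₚ.*-cong (toℚᵘ-/ m 0) (toℚᵘ-/ n 0) ⟨
  toℚᵘ (fromℕ m) ℚᵘ.* toℚᵘ (fromℕ n)      ≈⟨ toℚᵘ-homo-* (fromℕ m) (fromℕ n) ⟨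
  toℚᵘ (fromℕ m * fromℕ n)                ∎)
  where
  open ℚᵘₚ.≃-Reasoning
  cross : + (m N.* n) Z.* Z.1ℤ ≡ (+ m Z.* + n) Z.* Z.1ℤ
  cross = trans (ℤₚ.*-identityʳ _) (trans (ℤₚ.pos-* m n) (sym (ℤₚ.*-identityʳ _)))

fromℕ*1/ℕ : ∀ d .{{_ : NonZero d}} → fromℕ d * 1/ℕ d ≡ 1ℚ
fromℕ*1/ℕ (suc k) = toℚᵘ-injective (begin
  toℚᵘ (fromℕ (suc k) * 1/ℕ suc k)              ≈⟨ toℚᵘ-homo-* (fromℕ (suc k)) (1/ℕ suc k) ⟩
  toℚᵘ (fromℕ (suc k)) ℚᵘ.* toℚᵘ (1/ℕ suc k)    ≈⟨ ℚᵘₚ.*-cong (toℚᵘ-/ (suc k) 0) (toℚᵘ-/ 1 k) ⟩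
  ℚᵘ.mkℚᵘ (+ suc k) 0 ℚᵘ.* ℚᵘ.mkℚᵘ (+ 1) k      ≈⟨ ℚᵘ.*≡* (cong (λ x → + suc x) (solve (k ∷ []) ℕ-ring)) ⟩
  ℚᵘ.1ℚᵘ                                       ∎)
  where open ℚᵘₚ.≃-Reasoning

1/ℕ-*-fromℕ : ∀ d .{{_ : NonZero d}} x → 1/ℕ d * (fromℕ d * x) ≡ x
1/ℕ-*-fromℕ d x = begin
  1/ℕ d * (fromℕ d * x)    ≡⟨ *-assoc (1/ℕ d) (fromℕ d) x ⟨
  1/ℕ d * fromℕ d * x      ≡⟨ cong (_* x) (trans (*-comm (1/ℕ d) (fromℕ d)) (fromℕ*1/ℕ d)) ⟩
  1ℚ * x                   ≡⟨ *-identityˡ x ⟩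
  x                        ∎
  where open ≡-Reasoning

*-cancelˡ-fromℕ : ∀ d .{{_ : NonZero d}} {x y} → fromℕ d * x ≡ fromℕ d * y → x ≡ y
*-cancelˡ-fromℕ d {x} {y} eq =
  trans (sym (1/ℕ-*-fromℕ d x)) (trans (cong (1/ℕ d *_) eq) (1/ℕ-*-fromℕ d y))

1/ℕ-cong : ∀ {m n} .{{_ : NonZero m}} .{{_ : NonZero n}} → m ≡ n → 1/ℕ m ≡ 1/ℕ n
1/ℕ-cong refl = refl

1/ℕ-homo-* : ∀ m n .{{_ : NonZero m}} .{{_ : NonZero n}} →
             (1/ℕ (m N.* n)) {{ℕₚ.m*n≢0 m n}} ≡ 1/ℕ m * 1/ℕ n
1/ℕ-homo-* (suc a) (suc b) = toℚᵘ-injective (begin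
  toℚᵘ (1/ℕ (suc a N.* suc b))                  ≈⟨ toℚᵘ-/ 1 (b N.+ a N.* suc b) ⟩
  ℚᵘ.mkℚᵘ (+ 1) (b N.+ a N.* suc b)            ≈⟨ ℚᵘ.*≡* (cong (λ x → + suc x) (solve (a ∷ b ∷ []) ℕ-ring)) ⟩
  ℚᵘ.mkℚᵘ (+ 1) a ℚᵘ.* ℚᵘ.mkℚᵘ (+ 1) b          ≈⟨ ℚᵘₚ.*-cong (toℚᵘ-/ 1 a) (toℚᵘ-/ 1 b) ⟨
  toℚᵘ (1/ℕ suc a) ℚᵘ.* toℚᵘ (1/ℕ suc b)        ≈⟨ toℚᵘ-homo-* (1/ℕ suc a) (1/ℕ suc b) ⟨
  toℚᵘ (1/ℕ suc a * 1/ℕ suc b)                  ∎)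
  where open ℚᵘₚ.≃-Reasoning

invFact-suc : ∀ n → invFact (suc n) ≡ 1/ℕ (suc n) * invFact n
invFact-suc n = 1/ℕ-homo-* (suc n) (n !) {{_}} {{n !≢0}}

invPow2-+ : ∀ m n → invPow2 (m N.+ n) ≡ invPow2 m * invPow2 n
invPow2-+ m n = trans (1/ℕ-cong {{m^n≢0 2 (m N.+ n)}} {{ℕₚ.m*n≢0 (2 ^ m) (2 ^ n) {{m^n≢0 2 m}} {{m^n≢0 2 n}}}}
                                (ℕₚ.^-distribˡ-+-* 2 m n))
                      (1/ℕ-homo-* (2 ^ m) (2 ^ n) {{m^n≢0 2 m}} {{m^n≢0 2 n}})

fromℕ-suc*invFact-suc : ∀ n → fromℕ (suc n) * invFact (suc n) ≡ invFact n
fromℕ-suc*invFact-suc n = begin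
  fromℕ (suc n) * invFact (suc n)                ≡⟨ cong (fromℕ (suc n) *_) (invFact-suc n) ⟩
  fromℕ (suc n) * (1/ℕ (suc n) * invFact n)      ≡⟨ *-assoc (fromℕ (suc n)) (1/ℕ suc n) (invFact n) ⟨
  fromℕ (suc n) * 1/ℕ (suc n) * invFact n        ≡⟨ cong (_* invFact n) (fromℕ*1/ℕ (suc n)) ⟩
  1ℚ * invFact n                                 ≡⟨ *-identityˡ (invFact n) ⟩
  invFact n                                      ∎
  where open ≡-Reasoning

sumTo-cong : ∀ n {f g : ℕ → ℚ} → (∀ i → i ≤ n → f i ≡ g i) → sumTo n f ≡ sumTo n g
sumTo-cong zero    eq = eq 0 z≤n
sumTo-cong (suc n) eq = cong₂ _+_ (sumTo-cong n (λ i i≤n → eq i (ℕₚ.m≤n⇒m≤1+n i≤n))) (eq (suc n) ℕₚ.≤-refl)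

sumTo-zero : ∀ n {f : ℕ → ℚ} → (∀ i → i ≤ n → f i ≡ 0ℚ) → sumTo n f ≡ 0ℚ
sumTo-zero zero    eq = eq 0 z≤n
sumTo-zero (suc n) eq = trans (cong₂ _+_ (sumTo-zero n (λ i i≤n → eq i (ℕₚ.m≤n⇒m≤1+n i≤n))) (eq (suc n) ℕₚ.≤-refl))
                              (+-identityʳ 0ℚ)

sumTo-+ : ∀ n f g → sumTo n (λ i → f i + g i) ≡ sumTo n f + sumTo n g
sumTo-+ zero    f g = refl
sumTo-+ (suc n) f g = trans (cong (_+ (f (suc n) + g (suc n))) (sumTo-+ n f g))
                            (interchange (sumTo n f) (sumTo n g) (f (suc n)) (g (suc n)))
  where
  interchange : ∀ a b c d → (a + b) + (c + d) ≡ (a + c) + (b + d)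
  interchange = solve-∀ ℚ-ring

sumTo-*ˡ : ∀ n a f → a * sumTo n f ≡ sumTo n (λ i → a * f i)
sumTo-*ˡ zero    a f = refl
sumTo-*ˡ (suc n) a f = trans (*-distribˡ-+ a _ _) (cong (_+ a * f (suc n)) (sumTo-*ˡ n a f))

sumTo-*ʳ : ∀ n a f → sumTo n f * a ≡ sumTo n (λ i → f i * a)
sumTo-*ʳ n a f = trans (*-comm _ a) (trans (sumTo-*ˡ n a f) (sumTo-cong n (λ i _ → *-comm a (f i))))

sumTo-sucˡ : ∀ n f → sumTo (suc n) f ≡ f 0 + sumTo n (λ i → f (suc i))
sumTo-sucˡ zero    f = refl
sumTo-sucˡ (suc n) f = trans (cong (_+ f (suc (suc n))) (sumTo-sucˡ n f))
                             (+-assoc (f 0) (sumTo n (λ i → f (suc i))) (f (suc (suc n))))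

sumTo-reverse : ∀ n f → sumTo n f ≡ sumTo n (λ i → f (n ∸ i))
sumTo-reverse zero    f = refl
sumTo-reverse (suc n) f = begin
  sumTo n f + f (suc n)                       ≡⟨ +-comm (sumTo n f) (f (suc n)) ⟩
  f (suc n) + sumTo n f                       ≡⟨ cong (_+_ (f (suc n))) (sumTo-reverse n f) ⟩
  f (suc n) + sumTo n (λ i → f (n ∸ i))       ≡⟨ sumTo-sucˡ n (λ i → f (suc n ∸ i)) ⟨
  sumTo (suc n) (λ i → f (suc n ∸ i))         ∎
  where open ≡-Reasoning

sumTo-dropZeros : ∀ j n f → (∀ i → i < j → f i ≡ 0ℚ) → sumTo (j N.+ n) f ≡ sumTo n (λ k → f (j N.+ k))
sumTo-dropZeros zero    n f _     = refl
sumTo-dropZeros (suc j) n f zeros = begin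
  sumTo (suc (j N.+ n)) f                        ≡⟨ sumTo-sucˡ (j N.+ n) f ⟩
  f 0 + sumTo (j N.+ n) (λ i → f (suc i))        ≡⟨ cong₂ _+_ (zeros 0 (s≤s z≤n))
                                                     (sumTo-dropZeros j n (λ i → f (suc i)) (λ i i<j → zeros (suc i) (s≤s i<j))) ⟩
  0ℚ + sumTo n (λ k → f (suc (j N.+ k)))          ≡⟨ +-identityˡ _ ⟩
  sumTo n (λ k → f (suc j N.+ k))                ∎
  where open ≡-Reasoning

sumTo-triangle : ∀ n (F : ℕ → ℕ → ℚ) →
  sumTo n (λ i → sumTo i (F i)) ≡ sumTo n (λ j → sumTo (n ∸ j) (λ k → F (j N.+ k) j))
sumTo-triangle zero    F = refl
sumTo-triangle (suc n) F = begin
  sumTo n (λ i → sumTo i (F i)) + sumTo (suc n) (F (suc n))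
    ≡⟨ cong (_+ sumTo (suc n) (F (suc n))) (sumTo-triangle n F) ⟩
  R + (sumTo n (F (suc n)) + F (suc n) (suc n))
    ≡⟨ +-assoc R (sumTo n (F (suc n))) (F (suc n) (suc n)) ⟨
  (R + sumTo n (F (suc n))) + F (suc n) (suc n)
    ≡⟨ cong₂ _+_ (sumTo-+ n _ _) (cong (λ x → F x (suc n)) (ℕₚ.+-identityʳ (suc n))) ⟨
  sumTo n (λ j → sumTo (n ∸ j) (G j) + F (suc n) j) + G (suc n) 0
    ≡⟨ cong₂ _+_ (sumTo-cong n extend) (cong (λ m → sumTo m (G (suc n))) (ℕₚ.n∸n≡0 n)) ⟨
  sumTo (suc n) (λ j → sumTo (suc n ∸ j) (G j))
    ∎
  where
  open ≡-Reasoning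
  G : ℕ → ℕ → ℚ
  G j k = F (j N.+ k) j
  R : ℚ
  R = sumTo n (λ j → sumTo (n ∸ j) (G j))
  extend : ∀ j → j ≤ n → sumTo (suc n ∸ j) (G j) ≡ sumTo (n ∸ j) (G j) + F (suc n) j
  extend j j≤n rewrite ℕₚ.+-∸-assoc 1 j≤n =
    cong (λ m → sumTo (n ∸ j) (G j) + F m j) (trans (ℕₚ.+-suc j (n ∸ j)) (cong suc (ℕₚ.m+[n∸m]≡n j≤n)))

-- The commutative semiring of formal power series

infixl 6 _⊕_

_⊕_ : Series → Series → Series
(f ⊕ g) n = f n + g n

zeroS : Series
zeroS _ = 0ℚ

constS : ℚ → Series
constS a zero    = a
constS a (suc _) = 0ℚ

module ≗-Reasoning = SetoidReasoning (ℕ →-setoid ℚ)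

⊛-cong : ∀ {f f′ g g′} → f ≗ f′ → g ≗ g′ → (f ⊛ g) ≗ (f′ ⊛ g′)
⊛-cong f≗f′ g≗g′ n = sumTo-cong n (λ i _ → cong₂ _*_ (f≗f′ i) (g≗g′ (n ∸ i)))

⊛-congˡ : ∀ {f f′} g → f ≗ f′ → (f ⊛ g) ≗ (f′ ⊛ g)
⊛-congˡ g f≗f′ = ⊛-cong {g = g} f≗f′ (λ _ → refl)

⊛-congʳ : ∀ f {g g′} → g ≗ g′ → (f ⊛ g) ≗ (f ⊛ g′)
⊛-congʳ f g≗g′ = ⊛-cong {f = f} (λ _ → refl) g≗g′

⊕-cong : ∀ {f f′ g g′} → f ≗ f′ → g ≗ g′ → (f ⊕ g) ≗ (f′ ⊕ g′)
⊕-cong f≗f′ g≗g′ n = cong₂ _+_ (f≗f′ n) (g≗g′ n)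

⊕-congˡ : ∀ {f f′} g → f ≗ f′ → (f ⊕ g) ≗ (f′ ⊕ g)
⊕-congˡ g f≗f′ n = cong (_+ g n) (f≗f′ n)

⊕-congʳ : ∀ f {g g′} → g ≗ g′ → (f ⊕ g) ≗ (f ⊕ g′)
⊕-congʳ f g≗g′ n = cong (_+_ (f n)) (g≗g′ n)

⊕-cancelʳ : ∀ {f g} h → (f ⊕ h) ≗ (g ⊕ h) → f ≗ g
⊕-cancelʳ {f} {g} h eq n = ∙-cancelʳ (h n) (f n) (g n) (eq n)

⊛-comm : ∀ f g → (f ⊛ g) ≗ (g ⊛ f)
⊛-comm f g n = trans (sumTo-reverse n _) (sumTo-cong n (λ i i≤n →
  trans (cong (λ j → f (n ∸ i) * g j) (ℕₚ.m∸[m∸n]≡n i≤n)) (*-comm (f (n ∸ i)) (g i))))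

⊛-assoc : ∀ f g h → ((f ⊛ g) ⊛ h) ≗ (f ⊛ (g ⊛ h))
⊛-assoc f g h n = begin
  sumTo n (λ i → sumTo i (λ j → f j * g (i ∸ j)) * h (n ∸ i))
    ≡⟨ sumTo-cong n (λ i _ → sumTo-*ʳ i (h (n ∸ i)) _) ⟩
  sumTo n (λ i → sumTo i (λ j → f j * g (i ∸ j) * h (n ∸ i)))
    ≡⟨ sumTo-triangle n (λ i j → f j * g (i ∸ j) * h (n ∸ i)) ⟩
  sumTo n (λ j → sumTo (n ∸ j) (λ k → f j * g (j N.+ k ∸ j) * h (n ∸ (j N.+ k))))
    ≡⟨ sumTo-cong n (λ j _ → trans (sumTo-cong (n ∸ j) (λ k _ → reindex j k)) (sym (sumTo-*ˡ (n ∸ j) (f j) _))) ⟩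
  sumTo n (λ j → f j * sumTo (n ∸ j) (λ k → g k * h (n ∸ j ∸ k)))
    ∎
  where
  open ≡-Reasoning
  reindex : ∀ j k → f j * g (j N.+ k ∸ j) * h (n ∸ (j N.+ k)) ≡ f j * (g k * h (n ∸ j ∸ k))
  reindex j k = trans (cong₂ (λ a b → f j * g a * h b) (ℕₚ.m+n∸m≡n j k) (sym (ℕₚ.∸-+-assoc n j k)))
                      (*-assoc (f j) (g k) (h (n ∸ j ∸ k)))

⊛-distribʳ : ∀ f g h → ((g ⊕ h) ⊛ f) ≗ ((g ⊛ f) ⊕ (h ⊛ f))
⊛-distribʳ f g h n = trans (sumTo-cong n (λ i _ → *-distribʳ-+ (f (n ∸ i)) (g i) (h i))) (sumTo-+ n _ _)

⊛-zeroˡ : ∀ f → (zeroS ⊛ f) ≗ zeroS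
⊛-zeroˡ f n = sumTo-zero n (λ i _ → *-zeroˡ (f (n ∸ i)))

constS-⊛ : ∀ a f → (constS a ⊛ f) ≗ (λ n → a * f n)
constS-⊛ a f zero    = refl
constS-⊛ a f (suc n) = trans (sumTo-sucˡ n _)
  (trans (cong (_+_ (a * f (suc n))) (sumTo-zero n (λ i _ → *-zeroˡ (f (n ∸ i))))) (+-identityʳ _))

oneS≗constS-1 : oneS ≗ constS 1ℚ
oneS≗constS-1 zero    = refl
oneS≗constS-1 (suc n) = refl

⊛-identityˡ : ∀ f → (oneS ⊛ f) ≗ f
⊛-identityˡ f n = trans (⊛-congˡ f oneS≗constS-1 n) (trans (constS-⊛ 1ℚ f n) (*-identityˡ (f n)))

⊛-identityʳ : ∀ f → (f ⊛ oneS) ≗ f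
⊛-identityʳ f n = trans (⊛-comm f oneS n) (⊛-identityˡ f n)

series-commutativeSemiring : CommutativeSemiring _ _
series-commutativeSemiring = record
  { Carrier = Series ; _≈_ = _≗_ ; _+_ = _⊕_ ; _*_ = _⊛_ ; 0# = zeroS ; 1# = oneS
  ; isCommutativeSemiring = Biased.IsCommutativeSemiringˡ.isCommutativeSemiring record
    { +-isCommutativeMonoid = record
      { isMonoid = record
        { isSemigroup = record
          { isMagma = record { isEquivalence = ≗-isEquivalence ; ∙-cong = ⊕-cong }
          ; assoc   = λ f g h n → +-assoc (f n) (g n) (h n) }
        ; identity = (λ f n → +-identityˡ (f n)) , (λ f n → +-identityʳ (f n)) }
      ; comm = λ f g n → +-comm (f n) (g n) }
    ; *-isCommutativeMonoid = record
      { isMonoid = record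
        { isSemigroup = record
          { isMagma = record { isEquivalence = ≗-isEquivalence ; ∙-cong = ⊛-cong }
          ; assoc   = ⊛-assoc }
        ; identity = ⊛-identityˡ , ⊛-identityʳ }
      ; comm = ⊛-comm }
    ; distribʳ = ⊛-distribʳ
    ; zeroˡ    = ⊛-zeroˡ } }
  where ≗-isEquivalence = Setoid.isEquivalence (ℕ →-setoid ℚ)

open import Algebra.Solver.Ring.NaturalCoefficients.Default series-commutativeSemiring
  using (con) renaming (solve to ⊛-solve; _:+_ to _⊞_; _:*_ to _⊠_; _:=_ to _≔_)

-- Derivative

∂ : Series → Series
∂ f n = fromℕ (suc n) * f (suc n)

∂-cong : ∀ {f g} → f ≗ g → ∂ f ≗ ∂ g
∂-cong f≗g n = cong (fromℕ (suc n) *_) (f≗g (suc n))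

∂-⊕ : ∀ f g → ∂ (f ⊕ g) ≗ (∂ f ⊕ ∂ g)
∂-⊕ f g n = *-distribˡ-+ (fromℕ (suc n)) (f (suc n)) (g (suc n))

∂-oneS : ∂ oneS ≗ zeroS
∂-oneS n = *-zeroʳ (fromℕ (suc n))

∂-⊛ : ∀ f g → ∂ (f ⊛ g) ≗ ((∂ f ⊛ g) ⊕ (f ⊛ ∂ g))
∂-⊛ f g n = begin
  fromℕ (suc n) * sumTo (suc n) (λ i → f i * g (suc n ∸ i))
    ≡⟨ sumTo-*ˡ (suc n) (fromℕ (suc n)) _ ⟩
  sumTo (suc n) (λ i → fromℕ (suc n) * (f i * g (suc n ∸ i)))
    ≡⟨ sumTo-cong (suc n) split ⟩
  sumTo (suc n) (λ i → L i + R i)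
    ≡⟨ sumTo-+ (suc n) L R ⟩
  sumTo (suc n) L + sumTo (suc n) R
    ≡⟨ cong₂ _+_ sumL sumR ⟩
  (∂ f ⊛ g) n + (f ⊛ ∂ g) n
    ∎
  where
  open ≡-Reasoning
  L R : ℕ → ℚ
  L i = fromℕ i * f i * g (suc n ∸ i)
  R i = f i * (fromℕ (suc n ∸ i) * g (suc n ∸ i))
  distribute : ∀ a b x y → (a + b) * (x * y) ≡ a * x * y + x * (b * y)
  distribute = solve-∀ ℚ-ring
  split : ∀ i → i ≤ suc n → fromℕ (suc n) * (f i * g (suc n ∸ i)) ≡ L i + R i
  split i i≤1+n = trans (cong (λ m → fromℕ m * (f i * g (suc n ∸ i))) (sym (ℕₚ.m+[n∸m]≡n i≤1+n)))
    (trans (cong (_* (f i * g (suc n ∸ i))) (fromℕ-homo-+ i (suc n ∸ i)))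
           (distribute (fromℕ i) (fromℕ (suc n ∸ i)) (f i) (g (suc n ∸ i))))
  sumL : sumTo (suc n) L ≡ (∂ f ⊛ g) n
  sumL = trans (sumTo-sucˡ n L)
    (trans (cong (_+ sumTo n (λ i → L (suc i))) (trans (*-assoc 0ℚ (f 0) (g (suc n))) (*-zeroˡ (f 0 * g (suc n)))))
           (+-identityˡ _))
  sumR : sumTo (suc n) R ≡ (f ⊛ ∂ g) n
  sumR = trans (cong (_+_ (sumTo n R)) lastR)
    (trans (+-identityʳ (sumTo n R))
           (sumTo-cong n (λ i i≤n → cong (λ m → f i * (fromℕ m * g m)) (ℕₚ.+-∸-assoc 1 i≤n))))
    where
    lastR : R (suc n) ≡ 0ℚ
    lastR = trans (cong (λ m → f (suc n) * (fromℕ m * g m)) (ℕₚ.n∸n≡0 n))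
                  (trans (cong (f (suc n) *_) (*-zeroˡ (g 0))) (*-zeroʳ (f (suc n))))

leibniz : ∀ f g {f′ g′} → ∂ f ≗ f′ → ∂ g ≗ g′ → ∂ (f ⊛ g) ≗ ((f′ ⊛ g) ⊕ (f ⊛ g′))
leibniz f g ∂f ∂g n = trans (∂-⊛ f g n) (⊕-cong (⊛-congˡ g ∂f) (⊛-congʳ f ∂g) n)

∂-injective : ∀ {f g} → ∂ f ≗ ∂ g → f 0 ≡ g 0 → f ≗ g
∂-injective ∂f≗∂g f₀≡g₀ zero    = f₀≡g₀
∂-injective ∂f≗∂g f₀≡g₀ (suc n) = *-cancelˡ-fromℕ (suc n) (∂f≗∂g n)

∂-system-unique : ∀ (F G : ℕ → ℚ → ℚ) {X Y X′ Y′} →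
  (∀ n → ∂ X n ≡ F n (Y n)) → (∀ n → ∂ Y n ≡ G n (X n)) →
  (∀ n → ∂ X′ n ≡ F n (Y′ n)) → (∀ n → ∂ Y′ n ≡ G n (X′ n)) →
  X 0 ≡ X′ 0 → Y 0 ≡ Y′ 0 → X ≗ X′ × Y ≗ Y′
∂-system-unique F G {X} {Y} {X′} {Y′} ∂X ∂Y ∂X′ ∂Y′ x₀ y₀ = (proj₁ ∘ both) , (proj₂ ∘ both)
  where
  both : ∀ n → X n ≡ X′ n × Y n ≡ Y′ n
  both zero    = x₀ , y₀
  both (suc n) = *-cancelˡ-fromℕ (suc n) (trans (∂X n) (trans (cong (F n) (proj₂ (both n))) (sym (∂X′ n))))
               , *-cancelˡ-fromℕ (suc n) (trans (∂Y n) (trans (cong (G n) (proj₁ (both n))) (sym (∂Y′ n))))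

-- Hyperbolic functions

isEven-suc : ∀ n → isEven (suc n) ≡ not (isEven n)
isEven-suc zero    = refl
isEven-suc (suc n) = sym (trans (cong not (isEven-suc n)) (not-involutive (isEven n)))

private
  hyperbolicTerm : ℕ → ℕ → ℚ
  hyperbolicTerm e n = invFact n * invPow2 (e N.* n)

  ∂-hyperbolicTerm : ∀ e n → fromℕ (suc n) * hyperbolicTerm e (suc n) ≡ invPow2 e * hyperbolicTerm e n
  ∂-hyperbolicTerm e n = begin
    fromℕ (suc n) * (invFact (suc n) * invPow2 (e N.* suc n))
      ≡⟨ cong₂ (λ x y → fromℕ (suc n) * (x * y)) (invFact-suc n)
               (trans (cong invPow2 (ℕₚ.*-suc e n)) (invPow2-+ e (e N.* n))) ⟩
    fromℕ (suc n) * (1/ℕ (suc n) * invFact n * (invPow2 e * invPow2 (e N.* n)))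
      ≡⟨ rearrange (fromℕ (suc n)) (1/ℕ suc n) (invFact n) (invPow2 e) (invPow2 (e N.* n)) ⟩
    fromℕ (suc n) * 1/ℕ (suc n) * (invPow2 e * (invFact n * invPow2 (e N.* n)))
      ≡⟨ cong (_* (invPow2 e * hyperbolicTerm e n)) (fromℕ*1/ℕ (suc n)) ⟩
    1ℚ * (invPow2 e * hyperbolicTerm e n)
      ≡⟨ *-identityˡ _ ⟩
    invPow2 e * hyperbolicTerm e n
      ∎
    where
    open ≡-Reasoning
    rearrange : ∀ a b x h y → a * (b * x * (h * y)) ≡ a * b * (h * (x * y))
    rearrange = solve-∀ ℚ-ring

∂-coshS : ∀ e → ∂ (coshS e) ≗ (constS (invPow2 e) ⊛ sinhS e)
∂-coshS e n = trans (byParity (isEven (suc n)) (isEven n) (isEven-suc n)) (sym (constS-⊛ (invPow2 e) (sinhS e) n))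
  where
  byParity : ∀ b b′ → b ≡ not b′ →
    fromℕ (suc n) * (if b then hyperbolicTerm e (suc n) else 0ℚ) ≡ invPow2 e * (if b′ then 0ℚ else hyperbolicTerm e n)
  byParity false true  _ = trans (*-zeroʳ (fromℕ (suc n))) (sym (*-zeroʳ (invPow2 e)))
  byParity true  false _ = ∂-hyperbolicTerm e n

∂-sinhS : ∀ e → ∂ (sinhS e) ≗ (constS (invPow2 e) ⊛ coshS e)
∂-sinhS e n = trans (byParity (isEven (suc n)) (isEven n) (isEven-suc n)) (sym (constS-⊛ (invPow2 e) (coshS e) n))
  where
  byParity : ∀ b b′ → b ≡ not b′ →
    fromℕ (suc n) * (if b then 0ℚ else hyperbolicTerm e (suc n)) ≡ invPow2 e * (if b′ then hyperbolicTerm e n else 0ℚ)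
  byParity false true  _ = ∂-hyperbolicTerm e n
  byParity true  false _ = trans (*-zeroʳ (fromℕ (suc n))) (sym (*-zeroʳ (invPow2 e)))

coshS-0 : ∀ e → coshS e 0 ≡ 1ℚ
coshS-0 e = cong (λ m → invFact 0 * invPow2 m) (ℕₚ.*-zeroʳ e)

cosh²≗1+sinh² : ∀ e → (coshS e ⊛ coshS e) ≗ (oneS ⊕ (sinhS e ⊛ sinhS e))
cosh²≗1+sinh² e = ∂-injective (begin
  ∂ (c ⊛ c)                                  ≈⟨ leibniz c c (∂-coshS e) (∂-coshS e) ⟩
  ((a ⊛ s) ⊛ c) ⊕ (c ⊛ (a ⊛ s))              ≈⟨ ⊛-solve 3 (λ a s c → ((a ⊠ s) ⊠ c) ⊞ (c ⊠ (a ⊠ s))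
                                                    ≔ con 0 ⊞ (((a ⊠ c) ⊠ s) ⊞ (s ⊠ (a ⊠ c)))) (λ _ → refl) a s c ⟩
  zeroS ⊕ (((a ⊛ c) ⊛ s) ⊕ (s ⊛ (a ⊛ c)))    ≈⟨ ⊕-cong ∂-oneS (leibniz s s (∂-sinhS e) (∂-sinhS e)) ⟨
  ∂ oneS ⊕ ∂ (s ⊛ s)                         ≈⟨ ∂-⊕ oneS (s ⊛ s) ⟨
  ∂ (oneS ⊕ (s ⊛ s))                         ∎)
  (cong₂ _*_ (coshS-0 e) (coshS-0 e))
  where
  open ≗-Reasoning
  a = constS (invPow2 e)
  c = coshS e
  s = sinhS e

-- Composition

cons0 : Series → Series
cons0 a zero    = 0ℚ
cons0 a (suc j) = a j

θ : Series → Series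
θ a j = fromℕ j * a j

powS-vanish : ∀ g → g 0 ≡ 0ℚ → ∀ j i → i < j → powS g j i ≡ 0ℚ
powS-vanish g g₀ (suc j) i i<1+j = sumTo-zero i term
  where
  term : ∀ l → l ≤ i → g l * powS g j (i ∸ l) ≡ 0ℚ
  term zero    _   = trans (cong (_* powS g j i) g₀) (*-zeroˡ (powS g j i))
  term (suc l) l<i = trans (cong (g (suc l) *_) (powS-vanish g g₀ j (i ∸ suc l) i∸l<j)) (*-zeroʳ (g (suc l)))
    where
    i∸l<j : i ∸ suc l < j
    i∸l<j = ℕₚ.<-≤-trans (ℕₚ.∸-monoʳ-< (s≤s z≤n) l<i) (ℕₚ.≤-pred i<1+j)

compose-cong : ∀ {a b} g → a ≗ b → compose a g ≗ compose b g
compose-cong g a≗b n = sumTo-cong n (λ j _ → cong (_* powS g j n) (a≗b j))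

compose-congʳ : ∀ a {g h} → g ≗ h → compose a g ≗ compose a h
compose-congʳ a {g} {h} g≗h n = sumTo-cong n (λ j _ → cong (a j *_) (powS-cong j n))
  where
  powS-cong : ∀ j → powS g j ≗ powS h j
  powS-cong zero    = λ _ → refl
  powS-cong (suc j) = ⊛-cong g≗h (powS-cong j)

compose-⊕ : ∀ a b g → compose (a ⊕ b) g ≗ (compose a g ⊕ compose b g)
compose-⊕ a b g n = trans (sumTo-cong n (λ j _ → *-distribʳ-+ (powS g j n) (a j) (b j))) (sumTo-+ n _ _)

compose-constS : ∀ x g → compose (constS x) g ≗ constS x
compose-constS x g zero    = *-identityʳ x
compose-constS x g (suc n) = trans (sumTo-sucˡ n _)
  (trans (cong₂ _+_ (*-zeroʳ x) (sumTo-zero n (λ j _ → *-zeroˡ (powS g (suc j) (suc n))))) (+-identityˡ 0ℚ))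

compose-⊛ : ∀ a g h → g 0 ≡ 0ℚ → ∀ n → (compose a g ⊛ h) n ≡ sumTo n (λ j → a j * (powS g j ⊛ h) n)
compose-⊛ a g h g₀ n = begin
  sumTo n (λ i → sumTo i (λ j → a j * powS g j i) * h (n ∸ i))
    ≡⟨ sumTo-cong n (λ i _ → sumTo-*ʳ i (h (n ∸ i)) _) ⟩
  sumTo n (λ i → sumTo i (λ j → a j * powS g j i * h (n ∸ i)))
    ≡⟨ sumTo-triangle n (λ i j → a j * powS g j i * h (n ∸ i)) ⟩
  sumTo n (λ j → sumTo (n ∸ j) (λ k → a j * powS g j (j N.+ k) * h (n ∸ (j N.+ k))))
    ≡⟨ sumTo-cong n (λ j j≤n → trans (sumTo-cong (n ∸ j) (λ k _ → *-assoc (a j) _ _))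
                                     (trans (sym (sumTo-*ˡ (n ∸ j) (a j) _)) (cong (a j *_) (sym (inner j j≤n))))) ⟩
  sumTo n (λ j → a j * (powS g j ⊛ h) n)
    ∎
  where
  open ≡-Reasoning
  inner : ∀ j → j ≤ n → (powS g j ⊛ h) n ≡ sumTo (n ∸ j) (λ k → powS g j (j N.+ k) * h (n ∸ (j N.+ k)))
  inner j j≤n = trans (cong (λ m → sumTo m (λ i → powS g j i * h (n ∸ i))) (sym (ℕₚ.m+[n∸m]≡n j≤n)))
    (sumTo-dropZeros j (n ∸ j) _ (λ i i<j → trans (cong (_* h (n ∸ i)) (powS-vanish g g₀ j i i<j)) (*-zeroˡ (h (n ∸ i)))))

compose-cons0 : ∀ a g → g 0 ≡ 0ℚ → compose (cons0 a) g ≗ (g ⊛ compose a g)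
compose-cons0 a g g₀ n = begin
  compose (cons0 a) g n                          ≡⟨ shifted n ⟨
  sumTo n (λ j → a j * powS g (suc j) n)         ≡⟨ sumTo-cong n (λ j _ → cong (a j *_) (⊛-comm (powS g j) g n)) ⟨
  sumTo n (λ j → a j * (powS g j ⊛ g) n)         ≡⟨ compose-⊛ a g g g₀ n ⟨
  (compose a g ⊛ g) n                            ≡⟨ ⊛-comm (compose a g) g n ⟩
  (g ⊛ compose a g) n                            ∎
  where
  open ≡-Reasoning
  vanish : ∀ j i → i < j → powS g j i ≡ 0ℚ
  vanish = powS-vanish g g₀
  shifted : ∀ n → sumTo n (λ j → a j * powS g (suc j) n) ≡ compose (cons0 a) g n
  shifted zero    = trans (cong (a 0 *_) (vanish 1 0 (s≤s z≤n))) (trans (*-zeroʳ (a 0)) (sym (*-zeroˡ 1ℚ)))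
  shifted (suc m) = begin
    sumTo m (λ j → a j * powS g (suc j) (suc m)) + a (suc m) * powS g (suc (suc m)) (suc m)
      ≡⟨ cong (_+_ (sumTo m (λ j → a j * powS g (suc j) (suc m))))
              (trans (cong (a (suc m) *_) (vanish (suc (suc m)) (suc m) ℕₚ.≤-refl)) (*-zeroʳ (a (suc m)))) ⟩
    sumTo m (λ j → a j * powS g (suc j) (suc m)) + 0ℚ
      ≡⟨ +-identityʳ _ ⟩
    sumTo m (λ j → a j * powS g (suc j) (suc m))
      ≡⟨ +-identityˡ _ ⟨
    0ℚ + sumTo m (λ j → a j * powS g (suc j) (suc m))
      ≡⟨ cong (_+ sumTo m (λ j → a j * powS g (suc j) (suc m))) (*-zeroˡ (powS g 0 (suc m))) ⟨
    0ℚ * powS g 0 (suc m) + sumTo m (λ j → a j * powS g (suc j) (suc m))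
      ≡⟨ sumTo-sucˡ m _ ⟨
    compose (cons0 a) g (suc m)
      ∎

compose-θ : ∀ a g → g 0 ≡ 0ℚ → compose (θ a) g ≗ (g ⊛ compose (∂ a) g)
compose-θ a g g₀ n = trans (compose-cong g θ≗cons0∂ n) (compose-cons0 (∂ a) g g₀ n)
  where
  θ≗cons0∂ : θ a ≗ cons0 (∂ a)
  θ≗cons0∂ zero    = *-zeroˡ (a 0)
  θ≗cons0∂ (suc j) = refl

constS-⊕ : ∀ a b → (constS a ⊕ constS b) ≗ constS (a + b)
constS-⊕ a b zero    = refl
constS-⊕ a b (suc n) = refl

∂-powS : ∀ g j → ∂ (powS g (suc j)) ≗ (constS (fromℕ (suc j)) ⊛ (powS g j ⊛ ∂ g))
∂-powS g zero = begin
  ∂ (g ⊛ oneS)                            ≈⟨ leibniz g oneS (λ _ → refl) ∂-oneS ⟩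
  (∂ g ⊛ oneS) ⊕ (g ⊛ zeroS)              ≈⟨ ⊛-solve 2 (λ g d → (d ⊠ con 1) ⊞ (g ⊠ con 0) ≔ con 1 ⊠ (con 1 ⊠ d)) (λ _ → refl) g (∂ g) ⟩
  oneS ⊛ (oneS ⊛ ∂ g)                     ≈⟨ ⊛-congˡ (oneS ⊛ ∂ g) oneS≗constS-1 ⟩
  constS 1ℚ ⊛ (oneS ⊛ ∂ g)                ∎
  where open ≗-Reasoning
∂-powS g (suc j) = begin
  ∂ (g ⊛ P)                                          ≈⟨ leibniz g P (λ _ → refl) (∂-powS g j) ⟩
  (∂ g ⊛ (g ⊛ Q)) ⊕ (g ⊛ (constS (fromℕ (suc j)) ⊛ (Q ⊛ ∂ g)))
    ≈⟨ ⊛-solve 4 (λ g q d k → (d ⊠ (g ⊠ q)) ⊞ (g ⊠ (k ⊠ (q ⊠ d))) ≔ (con 1 ⊞ k) ⊠ ((g ⊠ q) ⊠ d)) (λ _ → refl)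
                 g Q (∂ g) (constS (fromℕ (suc j))) ⟩
  (oneS ⊕ constS (fromℕ (suc j))) ⊛ (P ⊛ ∂ g)       ≈⟨ ⊛-congˡ (P ⊛ ∂ g) count ⟩
  constS (fromℕ (suc (suc j))) ⊛ (P ⊛ ∂ g)           ∎
  where
  open ≗-Reasoning
  P = powS g (suc j)
  Q = powS g j
  count : (oneS ⊕ constS (fromℕ (suc j))) ≗ constS (fromℕ (suc (suc j)))
  count n = trans (⊕-congˡ (constS (fromℕ (suc j))) oneS≗constS-1 n)
                  (trans (constS-⊕ 1ℚ (fromℕ (suc j)) n) (cong (λ x → constS x n) (sym (fromℕ-homo-+ 1 (suc j)))))

∂-compose : ∀ a g → g 0 ≡ 0ℚ → ∂ (compose a g) ≗ (compose (∂ a) g ⊛ ∂ g)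
∂-compose a g g₀ n = begin
  fromℕ (suc n) * sumTo (suc n) (λ j → a j * powS g j (suc n))
    ≡⟨ sumTo-*ˡ (suc n) (fromℕ (suc n)) _ ⟩
  sumTo (suc n) (λ j → fromℕ (suc n) * (a j * powS g j (suc n)))
    ≡⟨ sumTo-sucˡ n _ ⟩
  fromℕ (suc n) * (a 0 * 0ℚ) + sumTo n (λ j → fromℕ (suc n) * (a (suc j) * powS g (suc j) (suc n)))
    ≡⟨ cong₂ _+_ (trans (cong (fromℕ (suc n) *_) (*-zeroʳ (a 0))) (*-zeroʳ (fromℕ (suc n))))
                 (sumTo-cong n (λ j _ → term j)) ⟩
  0ℚ + sumTo n (λ j → ∂ a j * (powS g j ⊛ ∂ g) n)
    ≡⟨ +-identityˡ _ ⟩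
  sumTo n (λ j → ∂ a j * (powS g j ⊛ ∂ g) n)
    ≡⟨ compose-⊛ (∂ a) g (∂ g) g₀ n ⟨
  (compose (∂ a) g ⊛ ∂ g) n
    ∎
  where
  open ≡-Reasoning
  swap : ∀ x y z → x * (y * z) ≡ y * x * z
  swap = solve-∀ ℚ-ring
  term : ∀ j → fromℕ (suc n) * (a (suc j) * powS g (suc j) (suc n)) ≡ ∂ a j * (powS g j ⊛ ∂ g) n
  term j = begin
    fromℕ (suc n) * (a (suc j) * powS g (suc j) (suc n))      ≡⟨ swap (fromℕ (suc n)) (a (suc j)) _ ⟩
    a (suc j) * fromℕ (suc n) * powS g (suc j) (suc n)        ≡⟨ *-assoc (a (suc j)) _ _ ⟩
    a (suc j) * ∂ (powS g (suc j)) n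
      ≡⟨ cong (a (suc j) *_) (trans (∂-powS g j n) (constS-⊛ (fromℕ (suc j)) (powS g j ⊛ ∂ g) n)) ⟩
    a (suc j) * (fromℕ (suc j) * (powS g j ⊛ ∂ g) n)          ≡⟨ swap (a (suc j)) (fromℕ (suc j)) _ ⟩
    ∂ a j * (powS g j ⊛ ∂ g) n                                ∎

⊛-invS : ∀ c → c 0 ≡ 1ℚ → (c ⊛ invS c) ≗ oneS
⊛-invS c c₀ = ⊕-cancelʳ (u ⊛ G) (begin
  (c ⊛ invS c) ⊕ (u ⊛ G)             ≈⟨ ⊕-congˡ (u ⊛ G) (⊛-congʳ c (compose-congʳ one u≗)) ⟩
  (c ⊛ G) ⊕ (u ⊛ G)                  ≈⟨ ⊛-distribʳ G c u ⟨
  (c ⊕ u) ⊛ G                        ≈⟨ ⊛-congˡ G c+u≗1 ⟩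
  oneS ⊛ G                           ≈⟨ ⊛-identityˡ G ⟩
  G                                  ≈⟨ compose-cong u one≗1+cons0one ⟩
  compose (constS 1ℚ ⊕ cons0 one) u  ≈⟨ compose-⊕ (constS 1ℚ) (cons0 one) u ⟩
  compose (constS 1ℚ) u ⊕ compose (cons0 one) u  ≈⟨ ⊕-cong (compose-constS 1ℚ u) (compose-cons0 one u refl) ⟩
  constS 1ℚ ⊕ (u ⊛ G)                ≈⟨ ⊕-congˡ (u ⊛ G) oneS≗constS-1 ⟨
  oneS ⊕ (u ⊛ G)                     ∎)
  where
  open ≗-Reasoning
  one : Series
  one _ = 1ℚ
  u : Series
  u zero    = 0ℚ
  u (suc n) = - c (suc n)
  G = compose one u
  u≗ : _ ≗ u
  u≗ zero    = refl
  u≗ (suc n) = refl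
  c+u≗1 : (c ⊕ u) ≗ oneS
  c+u≗1 zero    = trans (+-identityʳ (c 0)) c₀
  c+u≗1 (suc n) = +-inverseʳ (c (suc n))
  one≗1+cons0one : one ≗ (constS 1ℚ ⊕ cons0 one)
  one≗1+cons0one zero    = refl
  one≗1+cons0one (suc j) = refl

-- tanh(t/2) and A_{−m}(tanh(t/2))

sinh cosh sinh½ cosh½ ½ : Series
sinh  = sinhS 0
cosh  = coshS 0
sinh½ = sinhS 1
cosh½ = coshS 1
½     = constS (invPow2 1)

∂-sinh : ∂ sinh ≗ cosh
∂-sinh n = trans (∂-sinhS 0 n) (trans (constS-⊛ 1ℚ cosh n) (*-identityˡ (cosh n)))

∂-cosh : ∂ cosh ≗ sinh
∂-cosh n = trans (∂-coshS 0 n) (trans (constS-⊛ 1ℚ sinh n) (*-identityˡ (sinh n)))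

½⊕½ : (½ ⊕ ½) ≗ oneS
½⊕½ zero    = refl
½⊕½ (suc n) = refl

sinh≗2sinh½cosh½ : sinh ≗ ((sinh½ ⊛ cosh½) ⊕ (sinh½ ⊛ cosh½))
sinh≗2sinh½cosh½ = proj₁ (∂-system-unique (λ _ y → y) (λ _ x → x) ∂-sinh ∂-cosh ∂S₂ ∂C₂ refl refl)
  where
  open ≗-Reasoning
  S₂ C₂ : Series
  S₂ = (sinh½ ⊛ cosh½) ⊕ (sinh½ ⊛ cosh½)
  C₂ = (cosh½ ⊛ cosh½) ⊕ (sinh½ ⊛ sinh½)
  ∂S₂ : ∂ S₂ ≗ C₂
  ∂S₂ = begin
    ∂ S₂                                     ≈⟨ ∂-⊕ (sinh½ ⊛ cosh½) (sinh½ ⊛ cosh½) ⟩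
    ∂ (sinh½ ⊛ cosh½) ⊕ ∂ (sinh½ ⊛ cosh½)   ≈⟨ ⊕-cong ∂sc ∂sc ⟩
    (((½ ⊛ cosh½) ⊛ cosh½) ⊕ (sinh½ ⊛ (½ ⊛ sinh½))) ⊕ (((½ ⊛ cosh½) ⊛ cosh½) ⊕ (sinh½ ⊛ (½ ⊛ sinh½)))
      ≈⟨ ⊛-solve 3 (λ s c h → (((h ⊠ c) ⊠ c) ⊞ (s ⊠ (h ⊠ s))) ⊞ (((h ⊠ c) ⊠ c) ⊞ (s ⊠ (h ⊠ s)))
                              ≔ (h ⊞ h) ⊠ ((c ⊠ c) ⊞ (s ⊠ s))) (λ _ → refl) sinh½ cosh½ ½ ⟩
    (½ ⊕ ½) ⊛ C₂                             ≈⟨ ⊛-congˡ C₂ ½⊕½ ⟩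
    oneS ⊛ C₂                                ≈⟨ ⊛-identityˡ C₂ ⟩
    C₂                                       ∎
    where ∂sc = leibniz sinh½ cosh½ (∂-sinhS 1) (∂-coshS 1)
  ∂C₂ : ∂ C₂ ≗ S₂
  ∂C₂ = begin
    ∂ C₂                                     ≈⟨ ∂-⊕ (cosh½ ⊛ cosh½) (sinh½ ⊛ sinh½) ⟩
    ∂ (cosh½ ⊛ cosh½) ⊕ ∂ (sinh½ ⊛ sinh½)
      ≈⟨ ⊕-cong (leibniz cosh½ cosh½ (∂-coshS 1) (∂-coshS 1)) (leibniz sinh½ sinh½ (∂-sinhS 1) (∂-sinhS 1)) ⟩
    (((½ ⊛ sinh½) ⊛ cosh½) ⊕ (cosh½ ⊛ (½ ⊛ sinh½))) ⊕ (((½ ⊛ cosh½) ⊛ sinh½) ⊕ (sinh½ ⊛ (½ ⊛ cosh½)))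
      ≈⟨ ⊛-solve 3 (λ s c h → (((h ⊠ s) ⊠ c) ⊞ (c ⊠ (h ⊠ s))) ⊞ (((h ⊠ c) ⊠ s) ⊞ (s ⊠ (h ⊠ c)))
                              ≔ (h ⊞ h) ⊠ ((s ⊠ c) ⊞ (s ⊠ c))) (λ _ → refl) sinh½ cosh½ ½ ⟩
    (½ ⊕ ½) ⊛ S₂                             ≈⟨ ⊛-congˡ S₂ ½⊕½ ⟩
    oneS ⊛ S₂                                ≈⟨ ⊛-identityˡ S₂ ⟩
    S₂                                       ∎

tanhHalf-0 : tanhHalf 0 ≡ 0ℚ
tanhHalf-0 = *-zeroˡ (invS cosh½ 0)

cosh½⊛tanhHalf : (cosh½ ⊛ tanhHalf) ≗ sinh½
cosh½⊛tanhHalf = begin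
  cosh½ ⊛ (sinh½ ⊛ invS cosh½)     ≈⟨ ⊛-solve 3 (λ k s i → k ⊠ (s ⊠ i) ≔ s ⊠ (k ⊠ i)) (λ _ → refl) cosh½ sinh½ (invS cosh½) ⟩
  sinh½ ⊛ (cosh½ ⊛ invS cosh½)     ≈⟨ ⊛-congʳ sinh½ (⊛-invS cosh½ refl) ⟩
  sinh½ ⊛ oneS                     ≈⟨ ⊛-identityʳ sinh½ ⟩
  sinh½                            ∎
  where open ≗-Reasoning

cosh½²⊛∂tanhHalf : ((cosh½ ⊛ cosh½) ⊛ ∂ tanhHalf) ≗ ½
cosh½²⊛∂tanhHalf = ⊕-cancelʳ (½ ⊛ (sinh½ ⊛ sinh½)) (begin
  ((κ ⊛ κ) ⊛ ∂T) ⊕ (½ ⊛ (σ ⊛ σ))             ≈⟨ ⊕-congʳ ((κ ⊛ κ) ⊛ ∂T) (⊛-congʳ ½ (⊛-congʳ σ cosh½⊛tanhHalf)) ⟨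
  ((κ ⊛ κ) ⊛ ∂T) ⊕ (½ ⊛ (σ ⊛ (κ ⊛ T)))       ≈⟨ ⊛-solve 5 (λ k s t d h → ((k ⊠ k) ⊠ d) ⊞ (h ⊠ (s ⊠ (k ⊠ t)))
                                                               ≔ k ⊠ (((h ⊠ s) ⊠ t) ⊞ (k ⊠ d))) (λ _ → refl) κ σ T ∂T ½ ⟩
  κ ⊛ (((½ ⊛ σ) ⊛ T) ⊕ (κ ⊛ ∂T))             ≈⟨ ⊛-congʳ κ (leibniz κ T (∂-coshS 1) (λ _ → refl)) ⟨
  κ ⊛ ∂ (κ ⊛ T)                              ≈⟨ ⊛-congʳ κ (∂-cong cosh½⊛tanhHalf) ⟩
  κ ⊛ ∂ σ                                    ≈⟨ ⊛-congʳ κ (∂-sinhS 1) ⟩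
  κ ⊛ (½ ⊛ κ)                                ≈⟨ ⊛-solve 2 (λ k h → k ⊠ (h ⊠ k) ≔ h ⊠ (k ⊠ k)) (λ _ → refl) κ ½ ⟩
  ½ ⊛ (κ ⊛ κ)                                ≈⟨ ⊛-congʳ ½ (cosh²≗1+sinh² 1) ⟩
  ½ ⊛ (oneS ⊕ (σ ⊛ σ))                       ≈⟨ ⊛-solve 2 (λ h s → h ⊠ (con 1 ⊞ (s ⊠ s)) ≔ h ⊞ (h ⊠ (s ⊠ s))) (λ _ → refl) ½ σ ⟩
  ½ ⊕ (½ ⊛ (σ ⊛ σ))                          ∎)
  where
  open ≗-Reasoning
  κ = cosh½
  σ = sinh½
  T = tanhHalf
  ∂T = ∂ tanhHalf

sinh⊛∂tanhHalf : (sinh ⊛ ∂ tanhHalf) ≗ tanhHalf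
sinh⊛∂tanhHalf = begin
  sinh ⊛ ∂T                                  ≈⟨ ⊛-congˡ ∂T sinh≗2sinh½cosh½ ⟩
  ((σ ⊛ κ) ⊕ (σ ⊛ κ)) ⊛ ∂T                   ≈⟨ ⊛-identityʳ _ ⟨
  (((σ ⊛ κ) ⊕ (σ ⊛ κ)) ⊛ ∂T) ⊛ oneS          ≈⟨ ⊛-congʳ (((σ ⊛ κ) ⊕ (σ ⊛ κ)) ⊛ ∂T) (⊛-invS κ refl) ⟨
  (((σ ⊛ κ) ⊕ (σ ⊛ κ)) ⊛ ∂T) ⊛ (κ ⊛ κ⁻¹)
    ≈⟨ ⊛-solve 4 (λ s k d i → (((s ⊠ k) ⊞ (s ⊠ k)) ⊠ d) ⊠ (k ⊠ i) ≔ (s ⊠ (((k ⊠ k) ⊠ d) ⊞ ((k ⊠ k) ⊠ d))) ⊠ i)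
                 (λ _ → refl) σ κ ∂T κ⁻¹ ⟩
  (σ ⊛ (((κ ⊛ κ) ⊛ ∂T) ⊕ ((κ ⊛ κ) ⊛ ∂T))) ⊛ κ⁻¹
    ≈⟨ ⊛-congˡ κ⁻¹ (⊛-congʳ σ (⊕-cong cosh½²⊛∂tanhHalf cosh½²⊛∂tanhHalf)) ⟩
  (σ ⊛ (½ ⊕ ½)) ⊛ κ⁻¹                        ≈⟨ ⊛-congˡ κ⁻¹ (⊛-congʳ σ ½⊕½) ⟩
  (σ ⊛ oneS) ⊛ κ⁻¹                           ≈⟨ ⊛-congˡ κ⁻¹ (⊛-identityʳ σ) ⟩
  σ ⊛ κ⁻¹                                    ∎
  where
  open ≗-Reasoning
  κ = cosh½
  σ = sinh½
  κ⁻¹ = invS cosh½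
  ∂T = ∂ tanhHalf

A-tanhHalf : ℕ → Series
A-tanhHalf m = compose (ASeries m) tanhHalf

ASeries-suc : ∀ m → ASeries (suc m) ≗ θ (ASeries m)
ASeries-suc m j with isEven j
... | true  = sym (*-zeroʳ (fromℕ j))
... | false = trans (cong fromℕ (left-comm 2 j (j ^ m))) (fromℕ-homo-* j (2 N.* j ^ m))
  where
  left-comm : ∀ x y z → x N.* (y N.* z) ≡ y N.* (x N.* z)
  left-comm = solve-∀ ℕ-ring

A-tanhHalf-suc : ∀ m → A-tanhHalf (suc m) ≗ (sinh ⊛ ∂ (A-tanhHalf m))
A-tanhHalf-suc m = begin
  compose (ASeries (suc m)) T          ≈⟨ compose-cong T (ASeries-suc m) ⟩
  compose (θ (ASeries m)) T            ≈⟨ compose-θ (ASeries m) T tanhHalf-0 ⟩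
  T ⊛ G                                ≈⟨ ⊛-congˡ G sinh⊛∂tanhHalf ⟨
  (sinh ⊛ ∂ T) ⊛ G                     ≈⟨ ⊛-solve 3 (λ s d g → (s ⊠ d) ⊠ g ≔ s ⊠ (g ⊠ d)) (λ _ → refl) sinh (∂ T) G ⟩
  sinh ⊛ (G ⊛ ∂ T)                     ≈⟨ ⊛-congʳ sinh (∂-compose (ASeries m) T tanhHalf-0) ⟨
  sinh ⊛ ∂ (A-tanhHalf m)              ∎
  where
  open ≗-Reasoning
  T = tanhHalf
  G = compose (∂ (ASeries m)) T

A-tanhHalf-zero : A-tanhHalf 0 ≗ sinh
A-tanhHalf-zero = begin
  compose (ASeries 0) T                ≈⟨ compose-cong T ASeries-0≗cons0B ⟩
  compose (cons0 B) T                  ≈⟨ compose-cons0 B T tanhHalf-0 ⟩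
  T ⊛ G                                ≈⟨ ⊛-congˡ G sinh⊛∂tanhHalf ⟨
  (sinh ⊛ ∂ T) ⊛ G                     ≈⟨ ⊛-assoc sinh (∂ T) G ⟩
  sinh ⊛ (∂ T ⊛ G)                     ≈⟨ ⊛-congʳ sinh ∂T⊛G≗1 ⟩
  sinh ⊛ oneS                          ≈⟨ ⊛-identityʳ sinh ⟩
  sinh                                 ∎
  where
  open ≗-Reasoning
  T = tanhHalf
  κ = cosh½
  σ = sinh½
  two = oneS ⊕ oneS
  B : Series
  B j = ASeries 0 (suc j)
  G = compose B T
  ASeries-0≗cons0B : ASeries 0 ≗ cons0 B
  ASeries-0≗cons0B zero    = refl
  ASeries-0≗cons0B (suc j) = refl
  two≗constS : two ≗ constS (1ℚ + 1ℚ)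
  two≗constS zero    = refl
  two≗constS (suc n) = refl
  B≗2+cons0²B : B ≗ (two ⊕ cons0 (cons0 B))
  B≗2+cons0²B zero          = refl
  B≗2+cons0²B (suc zero)    = refl
  B≗2+cons0²B (suc (suc j)) = sym (+-identityˡ (B j))
  G≗2+T²G : G ≗ (two ⊕ (T ⊛ (T ⊛ G)))
  G≗2+T²G = begin
    G                                            ≈⟨ compose-cong T B≗2+cons0²B ⟩
    compose (two ⊕ cons0 (cons0 B)) T            ≈⟨ compose-⊕ two (cons0 (cons0 B)) T ⟩
    compose two T ⊕ compose (cons0 (cons0 B)) T  ≈⟨ ⊕-cong (compose-cong T two≗constS) (compose-cons0 (cons0 B) T tanhHalf-0) ⟩
    compose (constS (1ℚ + 1ℚ)) T ⊕ (T ⊛ compose (cons0 B) T)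
      ≈⟨ ⊕-cong (compose-constS (1ℚ + 1ℚ) T) (⊛-congʳ T (compose-cons0 B T tanhHalf-0)) ⟩
    constS (1ℚ + 1ℚ) ⊕ (T ⊛ (T ⊛ G))             ≈⟨ ⊕-congˡ (T ⊛ (T ⊛ G)) two≗constS ⟨
    two ⊕ (T ⊛ (T ⊛ G))                          ∎
  G≗2cosh½² : G ≗ ((κ ⊛ κ) ⊛ two)
  G≗2cosh½² = ⊕-cancelʳ ((σ ⊛ σ) ⊛ G) (begin
    G ⊕ ((σ ⊛ σ) ⊛ G)                        ≈⟨ ⊛-solve 2 (λ g q → g ⊞ (q ⊠ g) ≔ (con 1 ⊞ q) ⊠ g) (λ _ → refl) G (σ ⊛ σ) ⟩
    (oneS ⊕ (σ ⊛ σ)) ⊛ G                     ≈⟨ ⊛-congˡ G (cosh²≗1+sinh² 1) ⟨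
    (κ ⊛ κ) ⊛ G                              ≈⟨ ⊛-congʳ (κ ⊛ κ) G≗2+T²G ⟩
    (κ ⊛ κ) ⊛ (two ⊕ (T ⊛ (T ⊛ G)))          ≈⟨ ⊛-solve 3 (λ k t g → (k ⊠ k) ⊠ ((con 1 ⊞ con 1) ⊞ (t ⊠ (t ⊠ g)))
                                                    ≔ ((k ⊠ k) ⊠ (con 1 ⊞ con 1)) ⊞ (((k ⊠ t) ⊠ (k ⊠ t)) ⊠ g)) (λ _ → refl) κ T G ⟩
    ((κ ⊛ κ) ⊛ two) ⊕ (((κ ⊛ T) ⊛ (κ ⊛ T)) ⊛ G)  ≈⟨ ⊕-congʳ ((κ ⊛ κ) ⊛ two) (⊛-congˡ G (⊛-cong cosh½⊛tanhHalf cosh½⊛tanhHalf)) ⟩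
    ((κ ⊛ κ) ⊛ two) ⊕ ((σ ⊛ σ) ⊛ G)          ∎)
  ∂T⊛G≗1 : (∂ T ⊛ G) ≗ oneS
  ∂T⊛G≗1 = begin
    ∂ T ⊛ G                                  ≈⟨ ⊛-congʳ (∂ T) G≗2cosh½² ⟩
    ∂ T ⊛ ((κ ⊛ κ) ⊛ two)
      ≈⟨ ⊛-solve 2 (λ d q → d ⊠ (q ⊠ (con 1 ⊞ con 1)) ≔ (q ⊠ d) ⊞ (q ⊠ d)) (λ _ → refl) (∂ T) (κ ⊛ κ) ⟩
    ((κ ⊛ κ) ⊛ ∂ T) ⊕ ((κ ⊛ κ) ⊛ ∂ T)        ≈⟨ ⊕-cong cosh½²⊛∂tanhHalf cosh½²⊛∂tanhHalf ⟩
    ½ ⊕ ½                                    ≈⟨ ½⊕½ ⟩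
    oneS                                     ∎

-- Polynomials in sinh² t

sinh² : Series
sinh² = sinh ⊛ sinh

∂-sinh² : ∂ sinh² ≗ ((cosh ⊛ sinh) ⊕ (sinh ⊛ cosh))
∂-sinh² = leibniz sinh sinh ∂-sinh ∂-sinh

polySinh² : (ℕ → ℕ) → Series
polySinh² p = compose (fromℕ ∘ p) sinh²

-- (sinh t · P(sinh² t))′ = cosh t · (P + 2xP′)(sinh² t) and, with O = oddStep Q,
-- (sinh t · cosh t · Q(sinh² t))′ = (O + x(Q + O))(sinh² t).
oddStep : (ℕ → ℕ) → ℕ → ℕ
oddStep u i = u i N.+ (i N.* u i N.+ i N.* u i)

evenStep : (ℕ → ℕ) → ℕ → ℕ
evenStep v zero    = oddStep v 0
evenStep v (suc i) = oddStep v (suc i) N.+ (v i N.+ oddStep v i)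

∂-sinh⊛polySinh² : ∀ u → ∂ (sinh ⊛ polySinh² u) ≗ (cosh ⊛ polySinh² (oddStep u))
∂-sinh⊛polySinh² u = begin
  ∂ (sinh ⊛ P)                                      ≈⟨ leibniz sinh P ∂-sinh (∂-compose (fromℕ ∘ u) sinh² refl) ⟩
  (cosh ⊛ P) ⊕ (sinh ⊛ (P′ ⊛ ∂ sinh²))              ≈⟨ ⊕-congʳ (cosh ⊛ P) (⊛-congʳ sinh (⊛-congʳ P′ ∂-sinh²)) ⟩
  (cosh ⊛ P) ⊕ (sinh ⊛ (P′ ⊛ ((cosh ⊛ sinh) ⊕ (sinh ⊛ cosh))))
    ≈⟨ ⊛-solve 4 (λ c s p p′ → (c ⊠ p) ⊞ (s ⊠ (p′ ⊠ ((c ⊠ s) ⊞ (s ⊠ c))))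
                               ≔ c ⊠ (p ⊞ (((s ⊠ s) ⊠ p′) ⊞ ((s ⊠ s) ⊠ p′)))) (λ _ → refl) cosh sinh P P′ ⟩
  cosh ⊛ (P ⊕ ((sinh² ⊛ P′) ⊕ (sinh² ⊛ P′)))        ≈⟨ ⊛-congʳ cosh (⊕-congʳ P (⊕-cong θP θP)) ⟨
  cosh ⊛ (P ⊕ (compose (θ ιu) sinh² ⊕ compose (θ ιu) sinh²))
    ≈⟨ ⊛-congʳ cosh (⊕-congʳ P (compose-⊕ (θ ιu) (θ ιu) sinh²)) ⟨
  cosh ⊛ (P ⊕ compose (θ ιu ⊕ θ ιu) sinh²)         ≈⟨ ⊛-congʳ cosh (compose-⊕ ιu (θ ιu ⊕ θ ιu) sinh²) ⟨
  cosh ⊛ compose (ιu ⊕ (θ ιu ⊕ θ ιu)) sinh²        ≈⟨ ⊛-congʳ cosh (compose-cong sinh² coefficients) ⟨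
  cosh ⊛ polySinh² (oddStep u)                      ∎
  where
  open ≗-Reasoning
  ιu = fromℕ ∘ u
  P  = polySinh² u
  P′ = compose (∂ ιu) sinh²
  θP = compose-θ ιu sinh² refl
  coefficients : (fromℕ ∘ oddStep u) ≗ (ιu ⊕ (θ ιu ⊕ θ ιu))
  coefficients i = trans (fromℕ-homo-+ (u i) _) (cong (_+_ (ιu i))
    (trans (fromℕ-homo-+ (i N.* u i) _) (cong₂ _+_ (fromℕ-homo-* i (u i)) (fromℕ-homo-* i (u i)))))

∂-sinh⊛cosh⊛polySinh² : ∀ v → ∂ (sinh ⊛ (cosh ⊛ polySinh² v)) ≗ polySinh² (evenStep v)
∂-sinh⊛cosh⊛polySinh² v = begin
  ∂ (sinh ⊛ (cosh ⊛ P))                             ≈⟨ ∂-cong (⊛-solve 3 (λ s c p → s ⊠ (c ⊠ p) ≔ c ⊠ (s ⊠ p)) (λ _ → refl) sinh cosh P) ⟩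
  ∂ (cosh ⊛ (sinh ⊛ P))                             ≈⟨ leibniz cosh (sinh ⊛ P) ∂-cosh (∂-sinh⊛polySinh² v) ⟩
  (sinh ⊛ (sinh ⊛ P)) ⊕ (cosh ⊛ (cosh ⊛ O))
    ≈⟨ ⊛-solve 4 (λ s c p o → (s ⊠ (s ⊠ p)) ⊞ (c ⊠ (c ⊠ o)) ≔ ((s ⊠ s) ⊠ p) ⊞ ((c ⊠ c) ⊠ o)) (λ _ → refl) sinh cosh P O ⟩
  (sinh² ⊛ P) ⊕ ((cosh ⊛ cosh) ⊛ O)                 ≈⟨ ⊕-congʳ (sinh² ⊛ P) (⊛-congˡ O (cosh²≗1+sinh² 0)) ⟩
  (sinh² ⊛ P) ⊕ ((oneS ⊕ sinh²) ⊛ O)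
    ≈⟨ ⊛-solve 3 (λ z p o → (z ⊠ p) ⊞ ((con 1 ⊞ z) ⊠ o) ≔ o ⊞ (z ⊠ (p ⊞ o))) (λ _ → refl) sinh² P O ⟩
  O ⊕ (sinh² ⊛ (P ⊕ O))                             ≈⟨ ⊕-congʳ O (⊛-congʳ sinh² (compose-⊕ ιv ιO sinh²)) ⟨
  O ⊕ (sinh² ⊛ compose (ιv ⊕ ιO) sinh²)             ≈⟨ ⊕-congʳ O (compose-cons0 (ιv ⊕ ιO) sinh² refl) ⟨
  O ⊕ compose (cons0 (ιv ⊕ ιO)) sinh²               ≈⟨ compose-⊕ ιO (cons0 (ιv ⊕ ιO)) sinh² ⟨
  compose (ιO ⊕ cons0 (ιv ⊕ ιO)) sinh²              ≈⟨ compose-cong sinh² coefficients ⟨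
  polySinh² (evenStep v)                            ∎
  where
  open ≗-Reasoning
  ιv = fromℕ ∘ v
  ιO = fromℕ ∘ oddStep v
  P  = polySinh² v
  O  = polySinh² (oddStep v)
  coefficients : (fromℕ ∘ evenStep v) ≗ (ιO ⊕ cons0 (ιv ⊕ ιO))
  coefficients zero    = sym (+-identityʳ (ιO 0))
  coefficients (suc i) = trans (fromℕ-homo-+ (oddStep v (suc i)) _) (cong (_+_ (ιO (suc i))) (fromℕ-homo-+ (v i) _))

evenPoly oddPoly : ℕ → ℕ → ℕ
evenPoly zero    zero    = 1
evenPoly zero    (suc i) = 0
evenPoly (suc k)         = evenStep (oddPoly k)
oddPoly k                = oddStep (evenPoly k)

polySinh²-evenPoly-0 : polySinh² (evenPoly 0) ≗ oneS
polySinh²-evenPoly-0 n = begin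
  polySinh² (evenPoly 0) n         ≡⟨ compose-cong sinh² coefficients n ⟩
  compose (constS 1ℚ) sinh² n      ≡⟨ compose-constS 1ℚ sinh² n ⟩
  constS 1ℚ n                      ≡⟨ oneS≗constS-1 n ⟨
  oneS n                           ∎
  where
  open ≡-Reasoning
  coefficients : (fromℕ ∘ evenPoly 0) ≗ constS 1ℚ
  coefficients zero    = refl
  coefficients (suc i) = refl

A-tanhHalf-even : ∀ k → A-tanhHalf (2 N.* k) ≗ (sinh ⊛ polySinh² (evenPoly k))
A-tanhHalf-odd  : ∀ k → A-tanhHalf (suc (2 N.* k)) ≗ (sinh ⊛ (cosh ⊛ polySinh² (oddPoly k)))

A-tanhHalf-even zero n = begin
  A-tanhHalf 0 n                             ≡⟨ A-tanhHalf-zero n ⟩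
  sinh n                                     ≡⟨ ⊛-identityʳ sinh n ⟨
  (sinh ⊛ oneS) n                            ≡⟨ ⊛-congʳ sinh polySinh²-evenPoly-0 n ⟨
  (sinh ⊛ polySinh² (evenPoly 0)) n          ∎
  where open ≡-Reasoning
A-tanhHalf-even (suc k) = subst (λ m → A-tanhHalf m ≗ (sinh ⊛ polySinh² (evenPoly (suc k)))) (sym (ℕₚ.*-suc 2 k)) (begin
  A-tanhHalf (suc (suc (2 N.* k)))                          ≈⟨ A-tanhHalf-suc (suc (2 N.* k)) ⟩
  sinh ⊛ ∂ (A-tanhHalf (suc (2 N.* k)))                     ≈⟨ ⊛-congʳ sinh (∂-cong (A-tanhHalf-odd k)) ⟩
  sinh ⊛ ∂ (sinh ⊛ (cosh ⊛ polySinh² (oddPoly k)))          ≈⟨ ⊛-congʳ sinh (∂-sinh⊛cosh⊛polySinh² (oddPoly k)) ⟩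
  sinh ⊛ polySinh² (evenPoly (suc k))                       ∎)
  where open ≗-Reasoning
A-tanhHalf-odd k = begin
  A-tanhHalf (suc (2 N.* k))                                ≈⟨ A-tanhHalf-suc (2 N.* k) ⟩
  sinh ⊛ ∂ (A-tanhHalf (2 N.* k))                           ≈⟨ ⊛-congʳ sinh (∂-cong (A-tanhHalf-even k)) ⟩
  sinh ⊛ ∂ (sinh ⊛ polySinh² (evenPoly k))                  ≈⟨ ⊛-congʳ sinh (∂-sinh⊛polySinh² (evenPoly k)) ⟩
  sinh ⊛ (cosh ⊛ polySinh² (oddPoly k))                     ∎
  where open ≗-Reasoning

shiftS-⊛ : ∀ f g → f 0 ≡ 0ℚ → shiftS (f ⊛ g) ≗ (shiftS f ⊛ g)
shiftS-⊛ f g f₀ n = trans (sumTo-sucˡ n _)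
  (trans (cong (_+ (shiftS f ⊛ g) n) (trans (cong (_* g (suc n)) f₀) (*-zeroˡ (g (suc n))))) (+-identityˡ _))

polycotEGF-≗ : ∀ m X → A-tanhHalf m ≗ (sinh ⊛ X) → polycotEGF m ≗ (X ⊛ cosh)
polycotEGF-≗ m X A≗ = begin
  shiftS (A-tanhHalf m ⊛ cosh) ⊛ inv        ≈⟨ ⊛-congˡ inv (λ n → ⊛-congˡ cosh A≗ (suc n)) ⟩
  shiftS ((sinh ⊛ X) ⊛ cosh) ⊛ inv          ≈⟨ ⊛-congˡ inv (λ n → ⊛-assoc sinh X cosh (suc n)) ⟩
  shiftS (sinh ⊛ (X ⊛ cosh)) ⊛ inv          ≈⟨ ⊛-congˡ inv (shiftS-⊛ sinh (X ⊛ cosh) refl) ⟩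
  (shiftS sinh ⊛ (X ⊛ cosh)) ⊛ inv          ≈⟨ ⊛-solve 3 (λ a b i → (a ⊠ b) ⊠ i ≔ b ⊠ (a ⊠ i)) (λ _ → refl) (shiftS sinh) (X ⊛ cosh) inv ⟩
  (X ⊛ cosh) ⊛ (shiftS sinh ⊛ inv)          ≈⟨ ⊛-congʳ (X ⊛ cosh) (⊛-invS (shiftS sinh) refl) ⟩
  (X ⊛ cosh) ⊛ oneS                         ≈⟨ ⊛-identityʳ (X ⊛ cosh) ⟩
  X ⊛ cosh                                  ∎
  where
  open ≗-Reasoning
  inv = invS (shiftS sinh)

polycotEGF-odd : ∀ k → polycotEGF (suc (2 N.* k)) ≗ ((oneS ⊕ sinh²) ⊛ polySinh² (oddPoly k))
polycotEGF-odd k = begin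
  polycotEGF (suc (2 N.* k))                ≈⟨ polycotEGF-≗ (suc (2 N.* k)) (cosh ⊛ Q) (A-tanhHalf-odd k) ⟩
  (cosh ⊛ Q) ⊛ cosh                         ≈⟨ ⊛-solve 2 (λ c q → (c ⊠ q) ⊠ c ≔ (c ⊠ c) ⊠ q) (λ _ → refl) cosh Q ⟩
  (cosh ⊛ cosh) ⊛ Q                         ≈⟨ ⊛-congˡ Q (cosh²≗1+sinh² 0) ⟩
  (oneS ⊕ sinh²) ⊛ Q                        ∎
  where
  open ≗-Reasoning
  Q = polySinh² (oddPoly k)

-- Divisibility by powers of 2

Pow2Divisible : (ℕ → ℕ) → Set
Pow2Divisible p = ∀ i → 2 ^ i ∣ p i

oddStep-pow2 : ∀ {u} → Pow2Divisible u → Pow2Divisible (oddStep u)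
oddStep-pow2 2^i∣u i = ℕ∣.∣m∣n⇒∣m+n (2^i∣u i) (ℕ∣.∣m∣n⇒∣m+n 2^i∣iu 2^i∣iu)
  where 2^i∣iu = ℕ∣.∣-trans (2^i∣u i) (ℕ∣.n∣m*n i)

evenStep-pow2 : ∀ {v} → Pow2Divisible v → Pow2Divisible (evenStep v)
evenStep-pow2     2^i∣v zero    = ℕ∣.1∣ _
evenStep-pow2 {v} 2^i∣v (suc i) = ℕ∣.∣m∣n⇒∣m+n (oddStep-pow2 2^i∣v (suc i))
  (subst (2 ^ suc i ∣_) (sym (doubled (v i) i)) (ℕ∣.*-pres-∣ (ℕ∣.∣-refl {2}) (ℕ∣.∣-trans (2^i∣v i) (ℕ∣.n∣m*n (suc i)))))
  where
  doubled : ∀ x i → x N.+ (x N.+ (i N.* x N.+ i N.* x)) ≡ 2 N.* (suc i N.* x)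
  doubled = solve-∀ ℕ-ring

evenPoly-pow2 : ∀ k → Pow2Divisible (evenPoly k)
oddPoly-pow2  : ∀ k → Pow2Divisible (oddPoly k)
evenPoly-pow2 zero    zero    = ℕ∣.∣-refl
evenPoly-pow2 zero    (suc i) = _ ℕ∣.∣0
evenPoly-pow2 (suc k)         = evenStep-pow2 (oddPoly-pow2 k)
oddPoly-pow2 k                = oddStep-pow2 (evenPoly-pow2 k)

sumToℕ : ℕ → (ℕ → ℕ) → ℕ
sumToℕ zero    f = f 0
sumToℕ (suc n) f = sumToℕ n f N.+ f (suc n)

fromℕ-sumToℕ : ∀ n f → fromℕ (sumToℕ n f) ≡ sumTo n (fromℕ ∘ f)
fromℕ-sumToℕ zero    f = refl
fromℕ-sumToℕ (suc n) f = trans (fromℕ-homo-+ (sumToℕ n f) (f (suc n))) (cong (_+ fromℕ (f (suc n))) (fromℕ-sumToℕ n f))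

∣-sumToℕ : ∀ {d} n f → (∀ i → i ≤ n → d ∣ f i) → d ∣ sumToℕ n f
∣-sumToℕ zero    f d∣f = d∣f 0 z≤n
∣-sumToℕ (suc n) f d∣f = ℕ∣.∣m∣n⇒∣m+n (∣-sumToℕ n f (λ i i≤n → d∣f i (ℕₚ.m≤n⇒m≤1+n i≤n))) (d∣f (suc n) ℕₚ.≤-refl)

invFact-binomial : ∀ {n i} → i ≤ n → invFact i * invFact (n ∸ i) ≡ fromℕ (n C i) * invFact n
invFact-binomial {n} {i} i≤n = *-cancelˡ-fromℕ d {{d≢0}} (trans (trans lhs rearranged) (sym rhs))
  where
  d = i ! N.* (n ∸ i) !
  d≢0 = ℕₚ.m*n≢0 (i !) ((n ∸ i) !) {{i !≢0}} {{(n ∸ i) !≢0}}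
  interchange : ∀ a b x y → a * b * (x * y) ≡ a * x * (b * y)
  interchange = solve-∀ ℚ-ring
  lhs : fromℕ d * (invFact i * invFact (n ∸ i)) ≡ fromℕ (i !) * invFact i * (fromℕ ((n ∸ i) !) * invFact (n ∸ i))
  lhs = trans (cong (_* (invFact i * invFact (n ∸ i))) (fromℕ-homo-* (i !) ((n ∸ i) !)))
              (interchange (fromℕ (i !)) (fromℕ ((n ∸ i) !)) (invFact i) (invFact (n ∸ i)))
  rearranged : fromℕ (i !) * invFact i * (fromℕ ((n ∸ i) !) * invFact (n ∸ i)) ≡ 1ℚ
  rearranged = cong₂ _*_ (fromℕ*1/ℕ (i !) {{i !≢0}}) (fromℕ*1/ℕ ((n ∸ i) !) {{(n ∸ i) !≢0}})
  C*d≡n! : (n C i) N.* d ≡ n !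
  C*d≡n! = trans (cong (N._* d) (nCk≡n!/k![n-k]! i≤n)) (m/n*n≡m {{d≢0}} (k![n∸k]!∣n! i≤n))
  rhs : fromℕ d * (fromℕ (n C i) * invFact n) ≡ 1ℚ
  rhs = begin
    fromℕ d * (fromℕ (n C i) * invFact n)  ≡⟨ *-assoc (fromℕ d) (fromℕ (n C i)) (invFact n) ⟨
    fromℕ d * fromℕ (n C i) * invFact n    ≡⟨ cong (_* invFact n) (trans (*-comm (fromℕ d) _) (sym (fromℕ-homo-* (n C i) d))) ⟩
    fromℕ ((n C i) N.* d) * invFact n        ≡⟨ cong (λ m → fromℕ m * invFact n) C*d≡n! ⟩
    fromℕ (n !) * invFact n                ≡⟨ fromℕ*1/ℕ (n !) {{n !≢0}} ⟩
    1ℚ                                     ∎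
    where open ≡-Reasoning

^-∣-monoʳ : ∀ b {m n} → m ≤ n → b ^ m ∣ b ^ n
^-∣-monoʳ b {m} {n} m≤n = divides (b ^ (n ∸ m)) (begin
  b ^ n                      ≡⟨ cong (b ^_) (ℕₚ.m+[n∸m]≡n m≤n) ⟨
  b ^ (m N.+ (n ∸ m))        ≡⟨ ℕₚ.^-distribˡ-+-* b m (n ∸ m) ⟩
  b ^ m N.* b ^ (n ∸ m)      ≡⟨ ℕₚ.*-comm (b ^ m) (b ^ (n ∸ m)) ⟩
  b ^ (n ∸ m) N.* b ^ m      ∎)
  where open ≡-Reasoning

+-∸-+-≤ : ∀ x y a b → x N.+ y ∸ (a N.+ b) ≤ (x ∸ a) N.+ (y ∸ b)
+-∸-+-≤ x y a b = ℕₚ.m≤n+o⇒m∸n≤o (x N.+ y) (a N.+ b) (begin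
  x N.+ y                                    ≤⟨ ℕₚ.+-mono-≤ (ℕₚ.m≤n+m∸n x a) (ℕₚ.m≤n+m∸n y b) ⟩
  (a N.+ (x ∸ a)) N.+ (b N.+ (y ∸ b))        ≡⟨ interchange a (x ∸ a) b (y ∸ b) ⟩
  (a N.+ b) N.+ ((x ∸ a) N.+ (y ∸ b))        ∎)
  where
  open ℕₚ.≤-Reasoning
  interchange : ∀ p q r s → (p N.+ q) N.+ (r N.+ s) ≡ (p N.+ r) N.+ (q N.+ s)
  interchange = solve-∀ ℕ-ring

hurwitz : (ℕ → ℕ) → Series
hurwitz w n = fromℕ (w n) * invFact n

record Hurwitz₂ (a : ℕ) (f : Series) : Set where
  constructor hurwitz₂
  field
    numer     : ℕ → ℕ
    ≗-hurwitz : f ≗ hurwitz numer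
    2^∣numer  : ∀ n → 2 ^ (n ∸ a) ∣ numer n

Hurwitz₂-cong : ∀ {a f g} → f ≗ g → Hurwitz₂ a f → Hurwitz₂ a g
Hurwitz₂-cong f≗g (hurwitz₂ w f≗w 2^∣w) = hurwitz₂ w (λ n → trans (sym (f≗g n)) (f≗w n)) 2^∣w

δ₀ : ℕ → ℕ
δ₀ zero    = 1
δ₀ (suc _) = 0

hurwitz-δ₀ : hurwitz δ₀ ≗ oneS
hurwitz-δ₀ zero    = refl
hurwitz-δ₀ (suc n) = *-zeroˡ (invFact (suc n))

Hurwitz₂-oneS : ∀ a → Hurwitz₂ a oneS
Hurwitz₂-oneS a = hurwitz₂ δ₀ (λ n → sym (hurwitz-δ₀ n)) 2^∣δ₀
  where
  2^∣δ₀ : ∀ n → 2 ^ (n ∸ a) ∣ δ₀ n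
  2^∣δ₀ zero rewrite ℕₚ.0∸n≡0 a = ℕ∣.∣-refl
  2^∣δ₀ (suc n) = _ ℕ∣.∣0

Hurwitz₂-⊕ : ∀ {a f g} → Hurwitz₂ a f → Hurwitz₂ a g → Hurwitz₂ a (f ⊕ g)
Hurwitz₂-⊕ (hurwitz₂ v f≗v 2^∣v) (hurwitz₂ w g≗w 2^∣w) =
  hurwitz₂ (λ n → v n N.+ w n) sum≗ (λ n → ℕ∣.∣m∣n⇒∣m+n (2^∣v n) (2^∣w n))
  where
  sum≗ : ∀ n → _ ≡ fromℕ (v n N.+ w n) * invFact n
  sum≗ n = trans (cong₂ _+_ (f≗v n) (g≗w n))
    (trans (sym (*-distribʳ-+ (invFact n) (fromℕ (v n)) (fromℕ (w n)))) (cong (_* invFact n) (sym (fromℕ-homo-+ (v n) (w n)))))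

binomialConv : (ℕ → ℕ) → (ℕ → ℕ) → ℕ → ℕ
binomialConv v w n = sumToℕ n (λ i → (n C i) N.* v i N.* w (n ∸ i))

hurwitz-⊛ : ∀ v w → (hurwitz v ⊛ hurwitz w) ≗ hurwitz (binomialConv v w)
hurwitz-⊛ v w n = begin
  sumTo n (λ i → hurwitz v i * hurwitz w (n ∸ i))                  ≡⟨ sumTo-cong n term ⟩
  sumTo n (λ i → fromℕ ((n C i) N.* v i N.* w (n ∸ i)) * invFact n) ≡⟨ sumTo-*ʳ n (invFact n) _ ⟨
  sumTo n (λ i → fromℕ ((n C i) N.* v i N.* w (n ∸ i))) * invFact n ≡⟨ cong (_* invFact n) (fromℕ-sumToℕ n _) ⟨
  hurwitz (binomialConv v w) n                                     ∎
  where
  open ≡-Reasoning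
  regroup : ∀ a x b y → a * x * (b * y) ≡ a * b * (x * y)
  regroup = solve-∀ ℚ-ring
  reorder : ∀ a b c x → a * b * (c * x) ≡ c * a * b * x
  reorder = solve-∀ ℚ-ring
  term : ∀ i → i ≤ n → hurwitz v i * hurwitz w (n ∸ i) ≡ fromℕ ((n C i) N.* v i N.* w (n ∸ i)) * invFact n
  term i i≤n = begin
    fromℕ (v i) * invFact i * (fromℕ (w (n ∸ i)) * invFact (n ∸ i))
      ≡⟨ regroup (fromℕ (v i)) (invFact i) (fromℕ (w (n ∸ i))) (invFact (n ∸ i)) ⟩
    fromℕ (v i) * fromℕ (w (n ∸ i)) * (invFact i * invFact (n ∸ i))    ≡⟨ cong (fromℕ (v i) * fromℕ (w (n ∸ i)) *_) (invFact-binomial i≤n) ⟩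
    fromℕ (v i) * fromℕ (w (n ∸ i)) * (fromℕ (n C i) * invFact n)
      ≡⟨ reorder (fromℕ (v i)) (fromℕ (w (n ∸ i))) (fromℕ (n C i)) (invFact n) ⟩
    fromℕ (n C i) * fromℕ (v i) * fromℕ (w (n ∸ i)) * invFact n        ≡⟨ cong (_* invFact n) homo ⟨
    fromℕ ((n C i) N.* v i N.* w (n ∸ i)) * invFact n                  ∎
    where
    homo = trans (fromℕ-homo-* ((n C i) N.* v i) (w (n ∸ i))) (cong (_* fromℕ (w (n ∸ i))) (fromℕ-homo-* (n C i) (v i)))

Hurwitz₂-⊛ : ∀ {a b f g} → Hurwitz₂ a f → Hurwitz₂ b g → Hurwitz₂ (a N.+ b) (f ⊛ g)
Hurwitz₂-⊛ {a} {b} (hurwitz₂ v f≗v 2^∣v) (hurwitz₂ w g≗w 2^∣w) =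
  hurwitz₂ (binomialConv v w) (λ n → trans (⊛-cong f≗v g≗w n) (hurwitz-⊛ v w n)) 2^∣conv
  where
  2^∣conv : ∀ n → 2 ^ (n ∸ (a N.+ b)) ∣ binomialConv v w n
  2^∣conv n = ∣-sumToℕ n _ term
    where
    term : ∀ i → i ≤ n → 2 ^ (n ∸ (a N.+ b)) ∣ (n C i) N.* v i N.* w (n ∸ i)
    term i i≤n = ℕ∣.∣-trans (^-∣-monoʳ 2 exponent)
      (ℕ∣.∣-trans (ℕ∣.∣-reflexive (ℕₚ.^-distribˡ-+-* 2 (i ∸ a) (n ∸ i ∸ b)))
      (ℕ∣.∣-trans (ℕ∣.*-pres-∣ (2^∣v i) (2^∣w (n ∸ i)))
      (ℕ∣.∣-trans (ℕ∣.n∣m*n (n C i)) (ℕ∣.∣-reflexive (sym (ℕₚ.*-assoc (n C i) (v i) (w (n ∸ i))))))))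
      where
      exponent : n ∸ (a N.+ b) ≤ (i ∸ a) N.+ (n ∸ i ∸ b)
      exponent = subst (λ m → m ∸ (a N.+ b) ≤ (i ∸ a) N.+ (n ∸ i ∸ b)) (ℕₚ.m+[n∸m]≡n i≤n) (+-∸-+-≤ i (n ∸ i) a b)

Hurwitz₂-powS : ∀ {f} → Hurwitz₂ 1 f → ∀ j → Hurwitz₂ j (powS f j)
Hurwitz₂-powS hf zero    = Hurwitz₂-oneS 0
Hurwitz₂-powS hf (suc j) = Hurwitz₂-⊛ hf (Hurwitz₂-powS hf j)

Hurwitz₂-compose : ∀ {p g} → Pow2Divisible p → Hurwitz₂ 1 g → Hurwitz₂ 0 (compose (fromℕ ∘ p) g)
Hurwitz₂-compose {p} {g} 2^∣p hg = hurwitz₂ w compose≗ 2^∣w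
  where
  W : ℕ → ℕ → ℕ
  W j = Hurwitz₂.numer (Hurwitz₂-powS hg j)
  w : ℕ → ℕ
  w n = sumToℕ n (λ j → p j N.* W j n)
  compose≗ : ∀ n → compose (fromℕ ∘ p) g n ≡ hurwitz w n
  compose≗ n = begin
    sumTo n (λ j → fromℕ (p j) * powS g j n)                ≡⟨ sumTo-cong n (λ j _ → term j) ⟩
    sumTo n (λ j → fromℕ (p j N.* W j n) * invFact n)       ≡⟨ sumTo-*ʳ n (invFact n) _ ⟨
    sumTo n (λ j → fromℕ (p j N.* W j n)) * invFact n       ≡⟨ cong (_* invFact n) (fromℕ-sumToℕ n _) ⟨
    hurwitz w n                                             ∎
    where
    open ≡-Reasoning
    term : ∀ j → fromℕ (p j) * powS g j n ≡ fromℕ (p j N.* W j n) * invFact n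
    term j = trans (cong (fromℕ (p j) *_) (Hurwitz₂.≗-hurwitz (Hurwitz₂-powS hg j) n))
      (trans (sym (*-assoc (fromℕ (p j)) (fromℕ (W j n)) (invFact n))) (cong (_* invFact n) (sym (fromℕ-homo-* (p j) (W j n)))))
  2^∣w : ∀ n → 2 ^ n ∣ w n
  2^∣w n = ∣-sumToℕ n _ λ j j≤n →
    ℕ∣.∣-trans (ℕ∣.∣-reflexive (trans (cong (2 ^_) (sym (ℕₚ.m+[n∸m]≡n j≤n))) (ℕₚ.^-distribˡ-+-* 2 j (n ∸ j))))
               (ℕ∣.*-pres-∣ (2^∣p j) (Hurwitz₂.2^∣numer (Hurwitz₂-powS hg j) n))

∂-hurwitz : ∀ w → ∂ (hurwitz w) ≗ hurwitz (w ∘ suc)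
∂-hurwitz w n = begin
  fromℕ (suc n) * (fromℕ (w (suc n)) * invFact (suc n))   ≡⟨ left-comm (fromℕ (suc n)) (fromℕ (w (suc n))) (invFact (suc n)) ⟩
  fromℕ (w (suc n)) * (fromℕ (suc n) * invFact (suc n))   ≡⟨ cong (fromℕ (w (suc n)) *_) (fromℕ-suc*invFact-suc n) ⟩
  fromℕ (w (suc n)) * invFact n                           ∎
  where
  open ≡-Reasoning
  left-comm : ∀ x y z → x * (y * z) ≡ y * (x * z)
  left-comm = solve-∀ ℚ-ring

fromℕ-double : ∀ x → fromℕ (2 N.* x) ≡ fromℕ x + fromℕ x
fromℕ-double x = trans (fromℕ-homo-+ x (x N.+ 0)) (cong (λ y → fromℕ x + fromℕ y) (ℕₚ.+-identityʳ x))

Hurwitz₂-sinh² : Hurwitz₂ 1 sinh²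
Hurwitz₂-sinh² = hurwitz₂ zw
  (proj₁ (∂-system-unique F G {sinh²} {cosh ⊛ sinh} {hurwitz zw} {hurwitz ww} ∂sinh² ∂cosh⊛sinh ∂Z ∂W refl refl)) 2^∣zw
  where
  -- numerators of sinh² t and cosh t · sinh t, from (sinh²)′ = 2 cosh sinh and (cosh sinh)′ = 1 + 2 sinh²
  zw ww : ℕ → ℕ
  zw zero    = 0
  zw (suc n) = 2 N.* ww n
  ww zero    = 0
  ww (suc n) = δ₀ n N.+ 2 N.* zw n
  F G : ℕ → ℚ → ℚ
  F _ y = y + y
  G n x = oneS n + x + x
  ∂sinh² : ∀ n → ∂ sinh² n ≡ F n ((cosh ⊛ sinh) n)
  ∂sinh² n = trans (∂-sinh² n) (cong (_+_ ((cosh ⊛ sinh) n)) (⊛-comm sinh cosh n))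
  ∂cosh⊛sinh : ∀ n → ∂ (cosh ⊛ sinh) n ≡ G n (sinh² n)
  ∂cosh⊛sinh n = begin
    ∂ (cosh ⊛ sinh) n                   ≡⟨ leibniz cosh sinh ∂-cosh ∂-sinh n ⟩
    sinh² n + (cosh ⊛ cosh) n           ≡⟨ cong (_+_ (sinh² n)) (cosh²≗1+sinh² 0 n) ⟩
    sinh² n + (oneS n + sinh² n)        ≡⟨ rotate (sinh² n) (oneS n) ⟩
    oneS n + sinh² n + sinh² n          ∎
    where
    open ≡-Reasoning
    rotate : ∀ x e → x + (e + x) ≡ e + x + x
    rotate = solve-∀ ℚ-ring
  ∂Z : ∀ n → ∂ (hurwitz zw) n ≡ F n (hurwitz ww n)
  ∂Z n = trans (∂-hurwitz zw n)
    (trans (cong (_* invFact n) (fromℕ-double (ww n))) (*-distribʳ-+ (invFact n) (fromℕ (ww n)) (fromℕ (ww n))))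
  ∂W : ∀ n → ∂ (hurwitz ww) n ≡ G n (hurwitz zw n)
  ∂W n = trans (∂-hurwitz ww n) (begin
    fromℕ (δ₀ n N.+ 2 N.* zw n) * invFact n
      ≡⟨ cong (_* invFact n) (trans (fromℕ-homo-+ (δ₀ n) (2 N.* zw n)) (cong (_+_ (fromℕ (δ₀ n))) (fromℕ-double (zw n)))) ⟩
    (fromℕ (δ₀ n) + (fromℕ (zw n) + fromℕ (zw n))) * invFact n
      ≡⟨ distrib (fromℕ (δ₀ n)) (fromℕ (zw n)) (invFact n) ⟩
    hurwitz δ₀ n + hurwitz zw n + hurwitz zw n              ≡⟨ cong (λ x → x + hurwitz zw n + hurwitz zw n) (hurwitz-δ₀ n) ⟩
    oneS n + hurwitz zw n + hurwitz zw n                    ∎)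
    where
    open ≡-Reasoning
    distrib : ∀ d z f → (d + (z + z)) * f ≡ d * f + z * f + z * f
    distrib = solve-∀ ℚ-ring
  2^∣zw : ∀ n → 2 ^ (n ∸ 1) ∣ zw n
  2^∣ww : ∀ n → 2 ^ (n ∸ 1) ∣ ww n
  2^∣zw zero          = ℕ∣.1∣ _
  2^∣zw (suc zero)    = ℕ∣.1∣ _
  2^∣zw (suc (suc n)) = ℕ∣.*-pres-∣ (ℕ∣.∣-refl {2}) (2^∣ww (suc n))
  2^∣ww zero          = ℕ∣.1∣ _
  2^∣ww (suc zero)    = ℕ∣.1∣ _
  2^∣ww (suc (suc n)) = ℕ∣.*-pres-∣ (ℕ∣.∣-refl {2}) (2^∣zw (suc n))

Hurwitz₂-coeff : ∀ {a f} → Hurwitz₂ a f → ∀ n → ∃[ z ] fromℕ (n !) * f n ≡ (z Z.* + (2 ^ (n ∸ a))) / 1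
Hurwitz₂-coeff {a} {f} (hurwitz₂ w f≗w 2^∣w) n with 2^∣w n
... | divides q w≡q*2^ = + q , (begin
  fromℕ (n !) * f n                          ≡⟨ cong (fromℕ (n !) *_) (f≗w n) ⟩
  fromℕ (n !) * (fromℕ (w n) * invFact n)    ≡⟨ left-comm (fromℕ (n !)) (fromℕ (w n)) (invFact n) ⟩
  fromℕ (w n) * (fromℕ (n !) * invFact n)    ≡⟨ cong (fromℕ (w n) *_) (fromℕ*1/ℕ (n !) {{n !≢0}}) ⟩
  fromℕ (w n) * 1ℚ                           ≡⟨ *-identityʳ (fromℕ (w n)) ⟩
  fromℕ (w n)                                ≡⟨ cong fromℕ w≡q*2^ ⟩
  + (q N.* 2 ^ (n ∸ a)) / 1                  ≡⟨ cong (_/ 1) (ℤₚ.pos-* q (2 ^ (n ∸ a))) ⟩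
  (+ q Z.* + (2 ^ (n ∸ a))) / 1              ∎)
  where
  open ≡-Reasoning
  left-comm : ∀ x y z → x * (y * z) ≡ y * (x * z)
  left-comm = solve-∀ ℚ-ring

Hurwitz₂-polycotEGF-odd : ∀ k → Hurwitz₂ 1 (polycotEGF (suc (2 N.* k)))
Hurwitz₂-polycotEGF-odd k = Hurwitz₂-cong (λ n → sym (polycotEGF-odd k n))
  (Hurwitz₂-⊛ (Hurwitz₂-⊕ (Hurwitz₂-oneS 1) Hurwitz₂-sinh²) (Hurwitz₂-compose (oddPoly-pow2 k) Hurwitz₂-sinh²))

corollary3p11 : (n k : ℕ) → 1 ≤ n →
    ∃[ z ] Dhat (N.suc (2 N.* k)) (2 N.* n) ≡ (z Z.* + (2 ^ (2 N.* n ∸ 1))) / 1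
corollary3p11 n k _ = Hurwitz₂-coeff (Hurwitz₂-polycotEGF-odd k) (2 N.* n)
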